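{- Let $n\ge3$ and let $U(C_n,T_m)$ be the signed unicyclic graph obtained from a signed cycle $C_n$ and a signed tree $T_m$ on $m$ vertices by adding an edge between the root vertex of $T_m$ and a vertex $v$ of $C_n$. Let $\delta=1$ if $C_n$ is balanced and $\delta=-1$ otherwise. Then: (i) if $n$ is even and $T_m$ has no perfect matching, $\det U(C_n,T_m)=0$; (ii) if $n$ is even and $T_m$ has a perfect matching, $\det U(C_n,T_m)=(-1)^{m/2}\big(-2\delta+2(-1)^{n/2}\big)$; (iii) if $n$ is odd and $\{T_m,v\}$ has a perfect matching, $\det U(C_n,T_m)=(-1)^{(m+n)/2}$; (iv) if $n$ is odd and $T_m$ has a perfect matching, $\det U(C_n,T_m)=2\delta(-1)^{m/2}$.
   Context: A signed graph has edge weights in $\{1,-1\}$; its determinant is the determinant of its adjacency matrix (entry $=$ weight of the edge, $0$ for non-adjacent pairs and on the diagonal). A signed cycle is balanced if the product of its edge weights is positive. $\{T_m,v\}$ denotes the subgraph of $U(C_n,T_m)$ induced by the vertices of $T_m$ together with $v$. -}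

module Defs where

open import Data.Nat as ℕ using (ℕ; zero; suc; _≡ᵇ_; _∸_)
open import Data.Integer as ℤ using (ℤ; +_; -_; _*_; _+_; _^_)
open import Data.Fin using (Fin; zero; suc; toℕ; punchIn; splitAt; _↑ˡ_; _↑ʳ_; _≟_)
open import Data.Sum using (_⊎_; inj₁; inj₂)
open import Data.Bool using (Bool; true; false; if_then_else_; _∧_; _∨_)
open import Relation.Binary.PropositionalEquality using (_≡_; _≢_)
open import Relation.Binary.Construct.Closure.ReflexiveTransitive using (Star)
open import Relation.Nullary using (Dec; yes; no; does)
open import Data.Product using (_×_)

Matrix : ℕ → Set
Matrix k = Fin k → Fin k → ℤ

sumFin : ∀ {k} → (Fin k → ℤ) → ℤ
sumFin {zero}  f = + 0
sumFin {suc k} f = f zero + sumFin (λ i → f (suc i))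

prodFin : ∀ {k} → (Fin k → ℤ) → ℤ
prodFin {zero}  f = + 1
prodFin {suc k} f = f zero * prodFin (λ i → f (suc i))

det : ∀ {k} → Matrix k → ℤ
det {zero}  M = + 1
det {suc k} M =
  sumFin (λ j → ((- + 1) ^ toℕ j) * M zero j * det (λ r c → M (suc r) (punchIn j c)))

data Sgn : Set where
  pos neg : Sgn

sgn : Sgn → ℤ
sgn pos = + 1
sgn neg = - + 1

record IsSignedGraph {k : ℕ} (A : Matrix k) : Set where
  field
    symmetric : ∀ i j → A i j ≡ A j i
    loopless  : ∀ i → A i i ≡ + 0
    entries   : ∀ i j → A i j ≡ + 0 ⊎ (A i j ≡ + 1 ⊎ A i j ≡ - + 1)

Adj : ∀ {k} → Matrix k → Fin k → Fin k → Set
Adj A i j = A i j ≢ + 0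

Connected : ∀ {k} → Matrix k → Set
Connected A = ∀ i j → Star (Adj A) i j

-- number of ordered pairs (i , j) that are adjacent (= twice the edge number)
isEdgeℕ : ℤ → ℕ
isEdgeℕ (+ 0) = 0
isEdgeℕ _     = 1

sumFinℕ : ∀ {k} → (Fin k → ℕ) → ℕ
sumFinℕ {zero}  f = 0
sumFinℕ {suc k} f = f zero ℕ.+ sumFinℕ (λ i → f (suc i))

orderedEdgeCount : ∀ {k} → Matrix k → ℕ
orderedEdgeCount A = sumFinℕ (λ i → sumFinℕ (λ j → isEdgeℕ (A i j)))

IsTree : ∀ {m} → Matrix m → Set
IsTree {m} A = Connected A × orderedEdgeCount A ≡ 2 ℕ.* (m ∸ 1)

record PerfectMatching {k : ℕ} (A : Matrix k) : Set where
  field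
    μ          : Fin k → Fin k
    involutive : ∀ i → μ (μ i) ≡ i
    noFixed    : ∀ i → μ i ≢ i
    adjacent   : ∀ i → Adj A i (μ i)

HasPerfectMatching : ∀ {k} → Matrix k → Set
HasPerfectMatching A = PerfectMatching A

-- Signed cycle C_n on vertices 0..n-1; σ i is the sign of the edge {i, i+1 mod n}
next? : (n : ℕ) → Fin n → Fin n → Bool
next? n a b = (suc (toℕ a) ≡ᵇ toℕ b) ∨ ((suc (toℕ a) ≡ᵇ n) ∧ (toℕ b ≡ᵇ 0))

cycleMatrix : (n : ℕ) → (Fin n → Sgn) → Matrix n
cycleMatrix n σ a b =
  if next? n a b then sgn (σ a) else (if next? n b a then sgn (σ b) else + 0)

Balanced : ∀ {n} → (Fin n → Sgn) → Set
Balanced σ = prodFin (λ i → sgn (σ i)) ≡ + 1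

δ : ∀ {n} → (Fin n → Sgn) → ℤ
δ σ = if does (prodFin (λ i → sgn (σ i)) ℤ.≟ + 1) then + 1 else - + 1

-- U(C_n, T_m): vertices Fin (n + m); first n are the cycle, last m the tree.
-- The extra edge joins cycle vertex v and tree root r with sign τ.
linkEntry : ∀ {n m} → Fin n → Fin m → Sgn → Fin n → Fin m → ℤ
linkEntry v r τ a b = if does (a ≟ v) ∧ does (b ≟ r) then sgn τ else + 0

unicyclic : (n : ℕ) → (Fin n → Sgn) → Fin n → (m : ℕ) → Matrix m → Fin m → Sgn
          → Matrix (n ℕ.+ m)
unicyclic n σ v m T r τ i j with splitAt n i | splitAt n j
... | inj₁ a | inj₁ b = cycleMatrix n σ a b
... | inj₂ a | inj₂ b = T a b
... | inj₁ a | inj₂ b = linkEntry v r τ a b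
... | inj₂ a | inj₁ b = linkEntry v r τ b a

induced : ∀ {k l} → Matrix l → (Fin k → Fin l) → Matrix k
induced A f i j = A (f i) (f j)

treePlusV : (n : ℕ) → Fin n → (m : ℕ) → Fin (suc m) → Fin (n ℕ.+ m)
treePlusV n v m zero    = v ↑ˡ m
treePlusV n v m (suc b) = n ↑ʳ b

module Submission where

-- Deleting a pendant edge of the tree part that avoids the root r multiplies the determinant
-- by -1 and preserves the existence of perfect matchings of T and of {T, v}. Repeating this
-- leaves the bare cycle C_n (exactly when T has a perfect matching), the cycle with the root
-- hanging off v (exactly when {T, v} has one; r is then pendant at v, and deleting r and v
-- leaves the path C_n - v), or an isolated vertex (determinant 0). The four cases follow from
-- det C_n = p(n) - p(n - 2) + 2 (-1)^(n - 1) δ, where p(L) ∈ {0, ±1} is the determinant of a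
-- signed path on L vertices.

open import Defs

module FiniteSums where

  open import Data.Nat using (zero; suc)
  open import Data.Integer using (ℤ; +_; -_; _*_; _+_)
  open import Data.Integer.Properties
    using (+-identityʳ; +-comm; *-zeroʳ; *-identityʳ; *-identityˡ; *-assoc; *-distribˡ-+; neg-distrib-+; +-0-abelianGroup)
  open import Algebra.Properties.AbelianGroup +-0-abelianGroup using (∙-cancelʳ)
  open import Data.Integer.Tactic.RingSolver using (solve-∀)
  open import Data.Fin using (Fin; zero; suc; punchIn; fromℕ; inject₁)
  open import Data.Fin.Properties using (punchInᵢ≢i)
  open import Relation.Binary.PropositionalEquality

  sumFin-cong : ∀ {k} {f g : Fin k → ℤ} → (∀ i → f i ≡ g i) → sumFin f ≡ sumFin g
  sumFin-cong {zero}  e = refl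
  sumFin-cong {suc k} e = cong₂ _+_ (e zero) (sumFin-cong (λ i → e (suc i)))

  sumFin-zero : ∀ {k} {f : Fin k → ℤ} → (∀ i → f i ≡ + 0) → sumFin f ≡ + 0
  sumFin-zero {zero}  e = refl
  sumFin-zero {suc k} e rewrite e zero | sumFin-zero {k} (λ i → e (suc i)) = refl

  sumFin-+ : ∀ {k} (f g : Fin k → ℤ) → sumFin (λ i → f i + g i) ≡ sumFin f + sumFin g
  sumFin-+ {zero}  f g = refl
  sumFin-+ {suc k} f g rewrite sumFin-+ (λ i → f (suc i)) (λ i → g (suc i)) =
    +-interchange (f zero) (g zero) (sumFin (λ i → f (suc i))) (sumFin (λ i → g (suc i)))
    where
    +-interchange : ∀ a b c d → a + b + (c + d) ≡ a + c + (b + d)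
    +-interchange = solve-∀

  sumFin-neg : ∀ {k} (f : Fin k → ℤ) → sumFin (λ i → - f i) ≡ - sumFin f
  sumFin-neg {zero}  f = refl
  sumFin-neg {suc k} f rewrite sumFin-neg (λ i → f (suc i)) = sym (neg-distrib-+ (f zero) _)

  sumFin-*ˡ : ∀ {k} (c : ℤ) (f : Fin k → ℤ) → sumFin (λ i → c * f i) ≡ c * sumFin f
  sumFin-*ˡ {zero}  c f = sym (*-zeroʳ c)
  sumFin-*ˡ {suc k} c f rewrite sumFin-*ˡ c (λ i → f (suc i)) = sym (*-distribˡ-+ c (f zero) _)

  sumFin-extract : ∀ {k} (a : Fin (suc k)) (f : Fin (suc k) → ℤ) →
    sumFin f ≡ f a + sumFin (λ b → f (punchIn a b))
  sumFin-extract zero f = refl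
  sumFin-extract {suc k} (suc a) f rewrite sumFin-extract a (λ i → f (suc i)) =
    +-left-comm (f zero) (f (suc a)) (sumFin (λ b → f (suc (punchIn a b))))
    where
    +-left-comm : ∀ x y z → x + (y + z) ≡ y + (x + z)
    +-left-comm = solve-∀

  sumFin-single : ∀ {k} (q : Fin k) (f : Fin k → ℤ) → (∀ j → j ≢ q → f j ≡ + 0) → sumFin f ≡ f q
  sumFin-single {suc k} q f z = begin
    sumFin f                               ≡⟨ sumFin-extract q f ⟩
    f q + sumFin (λ b → f (punchIn q b))   ≡⟨ cong (λ x → f q + x) (sumFin-zero (λ b → z (punchIn q b) (punchInᵢ≢i q b))) ⟩
    f q + + 0                              ≡⟨ +-identityʳ (f q) ⟩
    f q                                    ∎
    where open ≡-Reasoning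

  sumFin-comm : ∀ {k l} (F : Fin k → Fin l → ℤ) →
    sumFin (λ i → sumFin (λ j → F i j)) ≡ sumFin (λ j → sumFin (λ i → F i j))
  sumFin-comm {zero}  {l} F = sym (sumFin-zero {l} (λ j → refl))
  sumFin-comm {suc k} F =
    trans (cong (λ x → sumFin (F zero) + x) (sumFin-comm (λ i j → F (suc i) j)))
          (sym (sumFin-+ (F zero) (λ j → sumFin (λ i → F (suc i) j))))

  private
    sumFin-offDiagonal+diagonal : ∀ {k} (H : Fin (suc k) → Fin (suc k) → ℤ) →
      sumFin (λ a → sumFin (λ b → H a (punchIn a b))) + sumFin (λ a → H a a)
      ≡ sumFin (λ a → sumFin (λ b → H a b))
    sumFin-offDiagonal+diagonal H =
      trans (sym (sumFin-+ (λ a → sumFin (λ b → H a (punchIn a b))) (λ a → H a a)))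
            (sumFin-cong λ a → trans (+-comm (sumFin (λ b → H a (punchIn a b))) (H a a))
                                     (sym (sumFin-extract a (H a))))

  sumFin-offDiagonal-comm : ∀ {k} (H : Fin (suc k) → Fin (suc k) → ℤ) →
    sumFin (λ a → sumFin (λ b → H a (punchIn a b))) ≡ sumFin (λ a → sumFin (λ b → H (punchIn a b) a))
  sumFin-offDiagonal-comm H = ∙-cancelʳ (sumFin (λ a → H a a)) _ _ (begin
    _ ≡⟨ sumFin-offDiagonal+diagonal H ⟩
    _ ≡⟨ sumFin-comm H ⟩
    _ ≡⟨ sym (sumFin-offDiagonal+diagonal (λ x y → H y x)) ⟩
    _ ∎)
    where open ≡-Reasoning

  prodFin-cong : ∀ {k} {f g : Fin k → ℤ} → (∀ i → f i ≡ g i) → prodFin f ≡ prodFin g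
  prodFin-cong {zero}  e = refl
  prodFin-cong {suc k} e = cong₂ _*_ (e zero) (prodFin-cong (λ i → e (suc i)))

  prodFin-snoc : ∀ {k} (f : Fin (suc k) → ℤ) → prodFin f ≡ prodFin (λ i → f (inject₁ i)) * f (fromℕ k)
  prodFin-snoc {zero}  f = trans (*-identityʳ (f zero)) (sym (*-identityˡ (f zero)))
  prodFin-snoc {suc k} f = trans (cong (f zero *_) (prodFin-snoc (λ i → f (suc i)))) (sym (*-assoc (f zero) _ _))

module Determinant where

  open FiniteSums
  open import Data.Nat as ℕ using (ℕ; zero; suc; _<_; s≤s; z≤n)
  open import Data.Integer using (ℤ; +_; -_; _*_; _+_; _^_)
  open import Data.Integer.Properties
    using (*-zeroˡ; *-zeroʳ; *-identityˡ; *-assoc; *-distribˡ-+; neg-distribˡ-*; neg-involutive; ^-distribˡ-+-*; -1*i≡-i)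
  open import Data.Integer.Tactic.RingSolver using (solve-∀)
  open import Data.Fin using (Fin; zero; suc; toℕ; punchIn; punchOut; cast; _≟_)
  open import Data.Fin.Properties using (punchIn-punchOut; punchInᵢ≢i; punchIn-injective; cast-is-id; cast-involutive)
  open import Data.Product using (Σ; _,_; proj₁; proj₂)
  open import Data.Sum using (_⊎_; inj₁; inj₂)
  open import Relation.Binary.PropositionalEquality
  open import Relation.Nullary using (yes; no)
  open import Data.Empty using (⊥-elim)
  open import Function using (_∘_)

  sign : ℕ → ℤ
  sign k = (- + 1) ^ k

  sign-suc : ∀ k → sign (suc k) ≡ - sign k
  sign-suc k = -1*i≡-i (sign k)

  sign-sq : ∀ k → sign k * sign k ≡ + 1
  sign-sq zero    = refl
  sign-sq (suc k) rewrite sign-suc k = trans (neg-*-neg (sign k)) (sign-sq k)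
    where
    neg-*-neg : ∀ x → (- x) * (- x) ≡ x * x
    neg-*-neg = solve-∀

  sign-cancel : ∀ k x → sign k * (sign k * x) ≡ x
  sign-cancel k x = trans (sym (*-assoc (sign k) (sign k) x))
                          (trans (cong (_* x) (sign-sq k)) (*-identityˡ x))

  sign-+ : ∀ a b → sign (a ℕ.+ b) ≡ sign a * sign b
  sign-+ = ^-distribˡ-+-* (- + 1)

  sign-double : ∀ q → sign (q ℕ.+ q) ≡ + 1
  sign-double q = trans (sign-+ q q) (sign-sq q)

  minor : ∀ {k} → Fin (suc k) → Fin (suc k) → Matrix (suc k) → Matrix k
  minor p q M r c = M (punchIn p r) (punchIn q c)

  det-cong : ∀ {k} {M N : Matrix k} → (∀ i j → M i j ≡ N i j) → det M ≡ det N
  det-cong {zero}  e = refl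
  det-cong {suc k} e = sumFin-cong λ j →
    cong₂ (λ x y → sign (toℕ j) * x * y) (e zero j) (det-cong (λ r c → e (suc r) (punchIn j c)))

  det-zeroColumn : ∀ {k} (M : Matrix k) (c : Fin k) → (∀ r → M r c ≡ + 0) → det M ≡ + 0
  det-zeroColumn {suc k} M c z = sumFin-zero term
    where
    term : ∀ j → sign (toℕ j) * M zero j * det (minor zero j M) ≡ + 0
    term j with j ≟ c
    ... | yes refl rewrite z zero | *-zeroʳ (sign (toℕ j)) = *-zeroˡ (det (minor zero j M))
    ... | no j≢c rewrite det-zeroColumn (minor zero j M) (punchOut j≢c)
                           (λ r → trans (cong (M (suc r)) (punchIn-punchOut j≢c)) (z (suc r)))
                       = *-zeroʳ (sign (toℕ j) * M zero j)

  -- A total punchOut; its value at u = w is junk.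
  punchOutᵗ : ∀ {n} → Fin (suc (suc n)) → Fin (suc (suc n)) → Fin (suc n)
  punchOutᵗ zero    zero    = zero
  punchOutᵗ zero    (suc w) = w
  punchOutᵗ (suc u) zero    = zero
  punchOutᵗ {suc n} (suc u) (suc w) = suc (punchOutᵗ u w)
  punchOutᵗ {zero}  (suc u) (suc w) = zero

  punchIn-punchOutᵗ : ∀ {n} (u w : Fin (suc (suc n))) → u ≢ w → punchIn u (punchOutᵗ u w) ≡ w
  punchIn-punchOutᵗ zero    zero    u≢w = ⊥-elim (u≢w refl)
  punchIn-punchOutᵗ zero    (suc w) u≢w = refl
  punchIn-punchOutᵗ (suc u) zero    u≢w = refl
  punchIn-punchOutᵗ {suc n} (suc u) (suc w) u≢w = cong suc (punchIn-punchOutᵗ u w (u≢w ∘ cong suc))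
  punchIn-punchOutᵗ {zero}  (suc zero) (suc zero) u≢w = ⊥-elim (u≢w refl)

  punchOutᵗ-punchIn : ∀ {n} (a : Fin (suc (suc n))) (b : Fin (suc n)) → punchOutᵗ a (punchIn a b) ≡ b
  punchOutᵗ-punchIn zero    b       = refl
  punchOutᵗ-punchIn (suc a) zero    = refl
  punchOutᵗ-punchIn {suc n} (suc a) (suc b) = cong suc (punchOutᵗ-punchIn a b)
  punchOutᵗ-punchIn {zero}  (suc zero) (suc ())

  -- The two orders of deleting u and w differ by exactly one transposition.
  sign-punchOutᵗ : ∀ {n} (u w : Fin (suc (suc n))) → u ≢ w →
    sign (toℕ u) * sign (toℕ (punchOutᵗ u w)) ≡ - (sign (toℕ w) * sign (toℕ (punchOutᵗ w u)))
  sign-punchOutᵗ zero zero u≢w = ⊥-elim (u≢w refl)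
  sign-punchOutᵗ zero (suc w) u≢w rewrite sign-suc (toℕ w) = ring (sign (toℕ w))
    where
    ring : ∀ x → + 1 * x ≡ - ((- x) * + 1)
    ring = solve-∀
  sign-punchOutᵗ (suc u) zero u≢w rewrite sign-suc (toℕ u) = ring (sign (toℕ u))
    where
    ring : ∀ x → (- x) * + 1 ≡ - (+ 1 * x)
    ring = solve-∀
  sign-punchOutᵗ {suc n} (suc u) (suc w) u≢w
    rewrite sign-suc (toℕ u) | sign-suc (toℕ w) | sign-suc (toℕ (punchOutᵗ u w)) | sign-suc (toℕ (punchOutᵗ w u))
    = trans (neg-*-neg (sign (toℕ u)) (sign (toℕ (punchOutᵗ u w))))
            (trans (sign-punchOutᵗ u w (u≢w ∘ cong suc))
                   (sym (cong -_ (neg-*-neg (sign (toℕ w)) (sign (toℕ (punchOutᵗ w u)))))))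
    where
    neg-*-neg : ∀ x y → (- x) * (- y) ≡ x * y
    neg-*-neg = solve-∀
  sign-punchOutᵗ {zero} (suc zero) (suc zero) u≢w = ⊥-elim (u≢w refl)

  punchIn₂ : ∀ {n} → Fin (suc (suc n)) → Fin (suc (suc n)) → Fin n → Fin (suc (suc n))
  punchIn₂ u w c = punchIn u (punchIn (punchOutᵗ u w) c)

  punchIn₂-comm : ∀ {n} (u w : Fin (suc (suc n))) → u ≢ w → ∀ c → punchIn₂ u w c ≡ punchIn₂ w u c
  punchIn₂-comm zero zero u≢w c = ⊥-elim (u≢w refl)
  punchIn₂-comm zero (suc zero) u≢w c = refl
  punchIn₂-comm {suc n} zero (suc (suc w)) u≢w c = refl
  punchIn₂-comm (suc zero) zero u≢w c = refl
  punchIn₂-comm {suc n} (suc (suc u)) zero u≢w c = refl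
  punchIn₂-comm {suc n} (suc zero)    (suc (suc w)) u≢w zero = refl
  punchIn₂-comm {suc n} (suc (suc u)) (suc zero)    u≢w zero = refl
  punchIn₂-comm {suc n} (suc (suc u)) (suc (suc w)) u≢w zero = refl
  punchIn₂-comm {suc n} (suc zero)    (suc zero)    u≢w zero = ⊥-elim (u≢w refl)
  punchIn₂-comm {suc n} (suc u) (suc w) u≢w (suc c) = cong suc (punchIn₂-comm u w (u≢w ∘ cong suc) c)
  punchIn₂-comm {zero} (suc zero) (suc zero) u≢w c = ⊥-elim (u≢w refl)

  punchIn₂-punchIn : ∀ {n} (a : Fin (suc (suc n))) (b : Fin (suc n)) c →
    punchIn₂ a (punchIn a b) c ≡ punchIn a (punchIn b c)
  punchIn₂-punchIn a b c = cong (λ x → punchIn a (punchIn x c)) (punchOutᵗ-punchIn a b)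

  punchIn₂≢ˡ : ∀ {n} (u w : Fin (suc (suc n))) c → punchIn₂ u w c ≢ u
  punchIn₂≢ˡ u w c = punchInᵢ≢i u _

  punchIn₂≢ʳ : ∀ {n} (u w : Fin (suc (suc n))) → u ≢ w → ∀ c → punchIn₂ u w c ≢ w
  punchIn₂≢ʳ u w u≢w c e = punchInᵢ≢i (punchOutᵗ u w) c
    (punchIn-injective u _ _ (trans e (sym (punchIn-punchOutᵗ u w u≢w))))

  punchIn₂-injective : ∀ {n} (u w : Fin (suc (suc n))) c d → punchIn₂ u w c ≡ punchIn₂ u w d → c ≡ d
  punchIn₂-injective u w c d e = punchIn-injective (punchOutᵗ u w) c d (punchIn-injective u _ _ e)

  punchIn₂-surjective : ∀ {n} (u w : Fin (suc (suc n))) → u ≢ w →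
    ∀ x → x ≢ u → x ≢ w → Σ (Fin n) λ c → punchIn₂ u w c ≡ x
  punchIn₂-surjective u w u≢w x x≢u x≢w =
    punchOut pᵤw≢y , trans (cong (punchIn u) (punchIn-punchOut pᵤw≢y)) (punchIn-punchOut u≢x)
    where
    u≢x : u ≢ x
    u≢x e = x≢u (sym e)
    pᵤw≢y : punchOutᵗ u w ≢ punchOut u≢x
    pᵤw≢y e = x≢w (trans (sym (punchIn-punchOut u≢x)) (trans (cong (punchIn u) (sym e)) (punchIn-punchOutᵗ u w u≢w)))

  punchIn₂-cases : ∀ {n} (u w : Fin (suc (suc n))) → u ≢ w →
    ∀ x → x ≡ u ⊎ x ≡ w ⊎ Σ (Fin n) λ c → punchIn₂ u w c ≡ x
  punchIn₂-cases u w u≢w x with x ≟ u | x ≟ w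
  ... | yes e   | _       = inj₁ e
  ... | no _    | yes e   = inj₂ (inj₁ e)
  ... | no x≢u  | no x≢w  = inj₂ (inj₂ (punchIn₂-surjective u w u≢w x x≢u x≢w))

  swap01 : ∀ {k} → Fin (suc (suc k)) → Fin (suc (suc k))
  swap01 zero          = suc zero
  swap01 (suc zero)    = zero
  swap01 (suc (suc x)) = suc (suc x)

  private
    twoRowTerm : ∀ {k} → Matrix (suc (suc k)) → Fin (suc (suc k)) → Fin (suc (suc k)) → ℤ
    twoRowTerm N x y = sign (toℕ x) * N zero x
      * (sign (toℕ (punchOutᵗ x y)) * N (suc zero) y * det (λ r c → N (suc (suc r)) (punchIn₂ x y c)))

    det-expandTwoRows : ∀ {k} (N : Matrix (suc (suc k))) →
      det N ≡ sumFin (λ a → sumFin (λ b → twoRowTerm N a (punchIn a b)))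
    det-expandTwoRows N = sumFin-cong λ a → trans
      (sym (sumFin-*ˡ (sign (toℕ a) * N zero a)
        (λ b → sign (toℕ b) * N (suc zero) (punchIn a b) * det (λ r c → N (suc (suc r)) (punchIn a (punchIn b c))))))
      (sumFin-cong λ b → cong (λ z → sign (toℕ a) * N zero a * z)
        (cong₂ (λ z w → sign (toℕ z) * N (suc zero) (punchIn a b) * w) (sym (punchOutᵗ-punchIn a b))
               (det-cong λ r c → cong (N (suc (suc r))) (sym (punchIn₂-punchIn a b c)))))

    twoRowTerm-swap01 : ∀ {k} (M : Matrix (suc (suc k))) a b →
      twoRowTerm (λ i j → M (swap01 i) j) (punchIn a b) a ≡ - twoRowTerm M a (punchIn a b)
    twoRowTerm-swap01 M a b =
      trans (cong (λ z → sign (toℕ y) * M (suc zero) y * (sign (toℕ (punchOutᵗ y a)) * M zero a * z)) same-minor)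
            (rearrange (sign (toℕ y)) (sign (toℕ (punchOutᵗ y a))) (sign (toℕ a)) (sign (toℕ (punchOutᵗ a y)))
                       (M (suc zero) y) (M zero a) (det (λ r c → M (suc (suc r)) (punchIn₂ a y c)))
                       (sign-punchOutᵗ a y (λ e → punchInᵢ≢i a b (sym e))))
      where
      y = punchIn a b
      same-minor : det (λ r c → M (suc (suc r)) (punchIn₂ y a c)) ≡ det (λ r c → M (suc (suc r)) (punchIn₂ a y c))
      same-minor = det-cong λ r c → cong (M (suc (suc r))) (punchIn₂-comm y a (punchInᵢ≢i a b) c)
      rearrange : ∀ p q s t m₁ m₀ d → s * t ≡ - (p * q) → p * m₁ * (q * m₀ * d) ≡ - (s * m₀ * (t * m₁ * d))
      rearrange p q s t m₁ m₀ d e = trans (ring₁ p q m₁ m₀ d)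
        (trans (cong (λ z → z * (m₁ * m₀ * d)) (sym (trans (cong -_ e) (neg-involutive _)))) (ring₂ s t m₁ m₀ d))
        where
        ring₁ : ∀ p q m₁ m₀ d → p * m₁ * (q * m₀ * d) ≡ (p * q) * (m₁ * m₀ * d)
        ring₁ = solve-∀
        ring₂ : ∀ s t m₁ m₀ d → - (s * t) * (m₁ * m₀ * d) ≡ - (s * m₀ * (t * m₁ * d))
        ring₂ = solve-∀

  -- Expand along the first two rows; the terms are indexed by ordered pairs of distinct columns,
  -- and swapping the rows exchanges the two columns of each pair.
  det-swap01 : ∀ {k} (M : Matrix (suc (suc k))) → det (λ i j → M (swap01 i) j) ≡ - det M
  det-swap01 M = begin
    det M′                                                           ≡⟨ det-expandTwoRows M′ ⟩
    sumFin (λ a → sumFin (λ b → twoRowTerm M′ a (punchIn a b)))      ≡⟨ sumFin-offDiagonal-comm (twoRowTerm M′) ⟩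
    sumFin (λ a → sumFin (λ b → twoRowTerm M′ (punchIn a b) a))      ≡⟨ sumFin-cong (λ a → sumFin-cong (twoRowTerm-swap01 M a)) ⟩
    sumFin (λ a → sumFin (λ b → - twoRowTerm M a (punchIn a b)))     ≡⟨ sumFin-cong (λ a → sumFin-neg (λ b → twoRowTerm M a (punchIn a b))) ⟩
    sumFin (λ a → - sumFin (λ b → twoRowTerm M a (punchIn a b)))     ≡⟨ sumFin-neg (λ a → sumFin (λ b → twoRowTerm M a (punchIn a b))) ⟩
    - sumFin (λ a → sumFin (λ b → twoRowTerm M a (punchIn a b)))     ≡⟨ cong -_ (sym (det-expandTwoRows M)) ⟩
    - det M                                                          ∎
    where
    open ≡-Reasoning
    M′ : Matrix _
    M′ i j = M (swap01 i) j

  private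
    fixZero : ∀ {k} → (Fin k → Fin k) → Fin (suc k) → Fin (suc k)
    fixZero π zero    = zero
    fixZero π (suc i) = suc (π i)

    det-fixZero : ∀ {k} (π : Fin k → Fin k) (s : ℤ) →
      (∀ (N : Matrix k) → det (λ i j → N (π i) j) ≡ s * det N) →
      ∀ (M : Matrix (suc k)) → det (λ i j → M (fixZero π i) j) ≡ s * det M
    det-fixZero π s H M =
      trans (sumFin-cong λ j → trans (cong (λ z → sign (toℕ j) * M zero j * z) (H (minor zero j M)))
                                     (left-comm (sign (toℕ j) * M zero j) s (det (minor zero j M))))
            (sumFin-*ˡ s (λ j → sign (toℕ j) * M zero j * det (minor zero j M)))
      where
      left-comm : ∀ a s d → a * (s * d) ≡ s * (a * d)
      left-comm = solve-∀

  moveToFront : ∀ {k} → Fin (suc k) → Fin (suc k) → Fin (suc k)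
  moveToFront u zero    = u
  moveToFront u (suc c) = punchIn u c

  det-moveToFront : ∀ {k} (u : Fin (suc k)) (M : Matrix (suc k)) →
    det (λ i j → M (moveToFront u i) j) ≡ sign (toℕ u) * det M
  det-moveToFront zero M = trans (det-cong unchanged) (sym (*-identityˡ (det M)))
    where
    unchanged : ∀ i j → M (moveToFront zero i) j ≡ M i j
    unchanged zero    j = refl
    unchanged (suc i) j = refl
  det-moveToFront {suc k} (suc u) M = begin
    det (λ i j → M (moveToFront (suc u) i) j)   ≡⟨ det-cong split ⟩
    det (λ i j → N (swap01 i) j)                ≡⟨ det-swap01 N ⟩
    - det N                                     ≡⟨ cong -_ (det-fixZero (moveToFront u) (sign (toℕ u)) (det-moveToFront u) M) ⟩
    - (sign (toℕ u) * det M)                    ≡⟨ neg-distribˡ-* (sign (toℕ u)) (det M) ⟩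
    - sign (toℕ u) * det M                      ≡⟨ cong (_* det M) (sym (sign-suc (toℕ u))) ⟩
    sign (suc (toℕ u)) * det M                  ∎
    where
    open ≡-Reasoning
    N : Matrix (suc (suc k))
    N i j = M (fixZero (moveToFront u) i) j
    split : ∀ i j → M (moveToFront (suc u) i) j ≡ N (swap01 i) j
    split zero          j = refl
    split (suc zero)    j = refl
    split (suc (suc i)) j = refl

  det-expandRow : ∀ {k} (p : Fin (suc k)) (M : Matrix (suc k)) →
    det M ≡ sign (toℕ p) * sumFin (λ j → sign (toℕ j) * M p j * det (minor p j M))
  det-expandRow p M = begin
    det M                                          ≡⟨ sym (sign-cancel (toℕ p) (det M)) ⟩
    sign (toℕ p) * (sign (toℕ p) * det M)          ≡⟨ cong (sign (toℕ p) *_) (sym (det-moveToFront p M)) ⟩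
    sign (toℕ p) * det (λ i j → M (moveToFront p i) j) ∎
    where open ≡-Reasoning

  det-zeroRow : ∀ {k} (M : Matrix k) (p : Fin k) → (∀ j → M p j ≡ + 0) → det M ≡ + 0
  det-zeroRow {suc k} M p z = begin
    det M                                                                   ≡⟨ det-expandRow p M ⟩
    sign (toℕ p) * sumFin (λ j → sign (toℕ j) * M p j * det (minor p j M)) ≡⟨ cong (sign (toℕ p) *_) (sumFin-zero term) ⟩
    sign (toℕ p) * + 0                                                      ≡⟨ *-zeroʳ (sign (toℕ p)) ⟩
    + 0                                                                     ∎
    where
    open ≡-Reasoning
    term : ∀ j → sign (toℕ j) * M p j * det (minor p j M) ≡ + 0
    term j rewrite z j | *-zeroʳ (sign (toℕ j)) = *-zeroˡ (det (minor p j M))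

  private
    det-singleTerm : ∀ {k} (M : Matrix (suc k)) (p q : Fin (suc k)) →
      (∀ j → j ≢ q → sign (toℕ j) * M p j * det (minor p j M) ≡ + 0) →
      det M ≡ sign (toℕ p) * sign (toℕ q) * M p q * det (minor p q M)
    det-singleTerm M p q z = begin
      det M                                                                   ≡⟨ det-expandRow p M ⟩
      sign (toℕ p) * sumFin (λ j → sign (toℕ j) * M p j * det (minor p j M)) ≡⟨ cong (sign (toℕ p) *_) (sumFin-single q _ z) ⟩
      sign (toℕ p) * (sign (toℕ q) * M p q * det (minor p q M))              ≡⟨ assoc (sign (toℕ p)) (sign (toℕ q)) (M p q) _ ⟩
      sign (toℕ p) * sign (toℕ q) * M p q * det (minor p q M)                ∎
      where
      open ≡-Reasoning
      assoc : ∀ a b c d → a * (b * c * d) ≡ a * b * c * d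
      assoc = solve-∀

  det-rowSingleton : ∀ {k} (M : Matrix (suc k)) (p q : Fin (suc k)) → (∀ j → j ≢ q → M p j ≡ + 0) →
    det M ≡ sign (toℕ p) * sign (toℕ q) * M p q * det (minor p q M)
  det-rowSingleton M p q z = det-singleTerm M p q λ j j≢q →
    trans (cong (λ x → sign (toℕ j) * x * det (minor p j M)) (z j j≢q))
          (trans (cong (_* det (minor p j M)) (*-zeroʳ (sign (toℕ j)))) (*-zeroˡ (det (minor p j M))))

  det-columnSingleton : ∀ {k} (M : Matrix (suc k)) (p q : Fin (suc k)) → (∀ i → i ≢ p → M i q ≡ + 0) →
    det M ≡ sign (toℕ p) * sign (toℕ q) * M p q * det (minor p q M)
  det-columnSingleton M p q z = det-singleTerm M p q λ j j≢q →
    trans (cong (sign (toℕ j) * M p j *_)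
                (det-zeroColumn (minor p j M) (punchOut j≢q)
                  (λ r → trans (cong (M (punchIn p r)) (punchIn-punchOut j≢q)) (z (punchIn p r) (punchInᵢ≢i p r)))))
          (*-zeroʳ (sign (toℕ j) * M p j))

  private
    det-firstRowLinear : ∀ {k} (M A B : Matrix (suc k)) →
      (∀ i j → A (suc i) j ≡ M (suc i) j) → (∀ i j → B (suc i) j ≡ M (suc i) j) →
      (∀ j → M zero j ≡ A zero j + B zero j) → det M ≡ det A + det B
    det-firstRowLinear M A B eA eB e₀ =
      trans (sumFin-cong λ j → trans (cong (λ z → sign (toℕ j) * z * det (minor zero j M)) (e₀ j))
        (trans (distrib (sign (toℕ j)) (A zero j) (B zero j) (det (minor zero j M)))
          (cong₂ _+_ (cong (λ z → sign (toℕ j) * A zero j * z) (det-cong λ r c → sym (eA r (punchIn j c))))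
                     (cong (λ z → sign (toℕ j) * B zero j * z) (det-cong λ r c → sym (eB r (punchIn j c)))))))
        (sumFin-+ (λ j → sign (toℕ j) * A zero j * det (minor zero j A))
                  (λ j → sign (toℕ j) * B zero j * det (minor zero j B)))
      where
      distrib : ∀ s a b d → s * (a + b) * d ≡ s * a * d + s * b * d
      distrib = solve-∀

  det-rowLinear : ∀ {k} (M A B : Matrix (suc k)) (p : Fin (suc k)) →
    (∀ i → i ≢ p → ∀ j → A i j ≡ M i j) → (∀ i → i ≢ p → ∀ j → B i j ≡ M i j) →
    (∀ j → M p j ≡ A p j + B p j) → det M ≡ det A + det B
  det-rowLinear M A B p eA eB eₚ = begin
    det M                                                 ≡⟨ det-expandRow p M ⟩
    sign (toℕ p) * det (frontRow p M)                     ≡⟨ cong (sign (toℕ p) *_) (det-firstRowLinear (frontRow p M) (frontRow p A) (frontRow p B)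
                                                              (λ i → eA (punchIn p i) (punchInᵢ≢i p i)) (λ i → eB (punchIn p i) (punchInᵢ≢i p i)) eₚ) ⟩
    sign (toℕ p) * (det (frontRow p A) + det (frontRow p B)) ≡⟨ *-distribˡ-+ (sign (toℕ p)) _ _ ⟩
    sign (toℕ p) * det (frontRow p A) + sign (toℕ p) * det (frontRow p B) ≡⟨ sym (cong₂ _+_ (det-expandRow p A) (det-expandRow p B)) ⟩
    det A + det B                                         ∎
    where
    open ≡-Reasoning
    frontRow : Fin _ → Matrix _ → Matrix _
    frontRow p N i j = N (moveToFront p i) j

  det-lowerTriangular : ∀ {k} (N : Matrix k) → (∀ r c → toℕ r < toℕ c → N r c ≡ + 0) → det N ≡ prodFin (λ i → N i i)
  det-lowerTriangular {zero}  N z = refl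
  det-lowerTriangular {suc k} N z =
    trans (det-rowSingleton N zero zero (λ { zero 0≢0 → ⊥-elim (0≢0 refl) ; (suc j) _ → z zero (suc j) (s≤s z≤n) }))
          (trans (cong (λ t → + 1 * + 1 * N zero zero * t)
                       (det-lowerTriangular (minor zero zero N) (λ r c lt → z (suc r) (suc c) (s≤s lt))))
                 (unit (N zero zero) _))
    where
    unit : ∀ a b → + 1 * + 1 * a * b ≡ a * b
    unit = solve-∀

  det-upperTriangular : ∀ {k} (N : Matrix k) → (∀ r c → toℕ c < toℕ r → N r c ≡ + 0) → det N ≡ prodFin (λ i → N i i)
  det-upperTriangular {zero}  N z = refl
  det-upperTriangular {suc k} N z =
    trans (det-columnSingleton N zero zero (λ { zero 0≢0 → ⊥-elim (0≢0 refl) ; (suc i) _ → z (suc i) zero (s≤s z≤n) }))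
          (trans (cong (λ t → + 1 * + 1 * N zero zero * t)
                       (det-upperTriangular (minor zero zero N) (λ r c lt → z (suc r) (suc c) (s≤s lt))))
                 (unit (N zero zero) _))
    where
    unit : ∀ a b → + 1 * + 1 * a * b ≡ a * b
    unit = solve-∀

  -- Expand along the pendant row u, then along the column of u in the minor, whose only
  -- nonzero entry is the symmetric one M w u.
  det-pendant : ∀ {k} (M : Matrix (suc (suc k))) → (∀ i j → M i j ≡ M j i) →
    (u w : Fin (suc (suc k))) → u ≢ w → (∀ j → j ≢ w → M u j ≡ + 0) → M u w * M u w ≡ + 1 →
    det M ≡ - det (λ r c → M (punchIn₂ u w r) (punchIn₂ u w c))
  det-pendant {k} M M-sym u w u≢w row-u unit-uw =
    trans (det-rowSingleton M u w row-u)
      (trans (cong (λ x → sign (toℕ u) * sign (toℕ w) * M u w * x) det-minor)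
        (collapse (sign (toℕ u)) (sign (toℕ w)) (sign (toℕ p)) (sign (toℕ q)) (M u w) D
                  (sign-punchOutᵗ u w u≢w) unit-uw (sign-sq (toℕ w)) (sign-sq (toℕ q))))
    where
    N = minor u w M
    p = punchOutᵗ u w
    q = punchOutᵗ w u
    D = det (λ r c → M (punchIn₂ u w r) (punchIn₂ u w c))
    w≢u : w ≢ u
    w≢u e = u≢w (sym e)
    column-q : ∀ i → i ≢ p → N i q ≡ + 0
    column-q i i≢p = trans (cong (M (punchIn u i)) (punchIn-punchOutᵗ w u w≢u))
      (trans (M-sym _ _) (row-u (punchIn u i) (λ e → i≢p (punchIn-injective u i p (trans e (sym (punchIn-punchOutᵗ u w u≢w)))))))
    det-minor : det N ≡ sign (toℕ p) * sign (toℕ q) * M u w * D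
    det-minor = trans (det-columnSingleton N p q column-q)
      (cong₂ (λ x y → sign (toℕ p) * sign (toℕ q) * x * y)
        (trans (cong₂ M (punchIn-punchOutᵗ u w u≢w) (punchIn-punchOutᵗ w u w≢u)) (M-sym w u))
        (det-cong λ r c → cong (M (punchIn₂ u w r)) (sym (punchIn₂-comm u w u≢w c))))
    collapse : ∀ a b c d m D → a * c ≡ - (b * d) → m * m ≡ + 1 → b * b ≡ + 1 → d * d ≡ + 1 →
      a * b * m * (c * d * m * D) ≡ - D
    collapse a b c d m D e mm bb dd =
      trans (ring₁ a b c d m D) (trans (cong (λ x → x * (b * d) * (m * m) * D) e)
      (trans (ring₂ b d m D) (trans (cong (λ x → - (x * (d * d) * (m * m) * D)) bb)
      (trans (cong (λ x → - (+ 1 * x * (m * m) * D)) dd)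
      (trans (cong (λ x → - (+ 1 * + 1 * x * D)) mm) (ring₃ D))))))
      where
      ring₁ : ∀ a b c d m D → a * b * m * (c * d * m * D) ≡ (a * c) * (b * d) * (m * m) * D
      ring₁ = solve-∀
      ring₂ : ∀ b d m D → - (b * d) * (b * d) * (m * m) * D ≡ - ((b * b) * (d * d) * (m * m) * D)
      ring₂ = solve-∀
      ring₃ : ∀ D → - (+ 1 * + 1 * + 1 * D) ≡ - D
      ring₃ = solve-∀

  det-cast : ∀ {a b} (e : a ≡ b) (M : Matrix b) → det (λ i j → M (cast e i) (cast e j)) ≡ det M
  det-cast refl M = det-cong (λ i j → cong₂ M (cast-is-id refl i) (cast-is-id refl j))

  -- The pendant lemma for index types that are only propositionally of the form Fin (2 + K).
  module Cast₂ {N K : ℕ} (E : suc (suc K) ≡ N) (u w : Fin N) where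

    private
      u′ w′ : Fin (suc (suc K))
      u′ = cast (sym E) u
      w′ = cast (sym E) w
      cast-u′ : cast E u′ ≡ u
      cast-u′ = cast-involutive E (sym E) u
      cast-w′ : cast E w′ ≡ w
      cast-w′ = cast-involutive E (sym E) w
      cast-injective : ∀ {x y : Fin (suc (suc K))} → cast E x ≡ cast E y → x ≡ y
      cast-injective {x} {y} e =
        trans (sym (cast-involutive (sym E) E x)) (trans (cong (cast (sym E)) e) (cast-involutive (sym E) E y))
      u′≢w′ : u ≢ w → u′ ≢ w′
      u′≢w′ u≢w e = u≢w (trans (sym cast-u′) (trans (cong (cast E) e) cast-w′))

    punchIn₂ᶜ : Fin K → Fin N
    punchIn₂ᶜ x = cast E (punchIn₂ u′ w′ x)

    punchIn₂ᶜ≢ˡ : ∀ x → punchIn₂ᶜ x ≢ u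
    punchIn₂ᶜ≢ˡ x e = punchIn₂≢ˡ u′ w′ x (cast-injective (trans e (sym cast-u′)))

    punchIn₂ᶜ≢ʳ : u ≢ w → ∀ x → punchIn₂ᶜ x ≢ w
    punchIn₂ᶜ≢ʳ u≢w x e = punchIn₂≢ʳ u′ w′ (u′≢w′ u≢w) x (cast-injective (trans e (sym cast-w′)))

    punchIn₂ᶜ-injective : ∀ x y → punchIn₂ᶜ x ≡ punchIn₂ᶜ y → x ≡ y
    punchIn₂ᶜ-injective x y e = punchIn₂-injective u′ w′ x y (cast-injective e)

    punchIn₂ᶜ-surjective : u ≢ w → ∀ z → z ≢ u → z ≢ w → Σ (Fin K) λ x → punchIn₂ᶜ x ≡ z
    punchIn₂ᶜ-surjective u≢w z z≢u z≢w = proj₁ P , trans (cong (cast E) (proj₂ P)) (cast-involutive E (sym E) z)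
      where
      P = punchIn₂-surjective u′ w′ (u′≢w′ u≢w) (cast (sym E) z)
            (λ e → z≢u (trans (sym (cast-involutive E (sym E) z)) (trans (cong (cast E) e) cast-u′)))
            (λ e → z≢w (trans (sym (cast-involutive E (sym E) z)) (trans (cong (cast E) e) cast-w′)))

    det-pendantᶜ : (M : Matrix N) → (∀ i j → M i j ≡ M j i) → u ≢ w →
      (∀ j → j ≢ w → M u j ≡ + 0) → M u w * M u w ≡ + 1 →
      det M ≡ - det (λ i j → M (punchIn₂ᶜ i) (punchIn₂ᶜ j))
    det-pendantᶜ M M-sym u≢w row-u unit-uw = trans (sym (det-cast E M))
      (det-pendant (λ i j → M (cast E i) (cast E j)) (λ i j → M-sym _ _) u′ w′ (u′≢w′ u≢w)
        (λ j j≢w′ → trans (cong (λ t → M t (cast E j)) cast-u′)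
                          (row-u (cast E j) (λ e → j≢w′ (cast-injective (trans e (sym cast-w′))))))
        (subst₂ (λ x y → M x y * M x y ≡ + 1) (sym cast-u′) (sym cast-w′) unit-uw))

module SignedPath where

  open Determinant
  open import Data.Nat as ℕ using (ℕ; zero; suc; _≤_; _<_; z≤n; s≤s)
  open import Data.Nat.Properties using (≤-trans; ≤-refl; n≤1+n; n<1+n; <-irrefl; <-≤-trans; m<m+n; +-suc; 1+n≢n; m≤n⇒m<n∨m≡n)
  open import Data.Integer using (ℤ; +_; -_; _*_)
  open import Data.Integer.Properties using (_≟_)
  open import Data.Fin using (Fin; zero; suc)
  open import Data.Product using (Σ; _,_; proj₁; proj₂; _×_)
  open import Data.Sum using (_⊎_; inj₁; inj₂)
  open import Relation.Binary.PropositionalEquality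
  open import Relation.Nullary using (yes; no)
  open import Data.Empty using (⊥-elim)

  pathDet : ℕ → ℤ
  pathDet zero          = + 1
  pathDet (suc zero)    = + 0
  pathDet (suc (suc L)) = - pathDet L

  pathDet-even : ∀ q → pathDet (q ℕ.+ q) ≡ sign q
  pathDet-even zero    = refl
  pathDet-even (suc q) = trans (cong pathDet (cong suc (+-suc q q))) (trans (cong -_ (pathDet-even q)) (sym (sign-suc q)))

  pathDet-odd : ∀ q → pathDet (suc (q ℕ.+ q)) ≡ + 0
  pathDet-odd zero    = refl
  pathDet-odd (suc q) = trans (cong pathDet (cong suc (cong suc (+-suc q q)))) (cong -_ (pathDet-odd q))

  module Path {K} (M : Matrix K) (M-sym : ∀ i j → M i j ≡ M j i) (φ : ℕ → Fin K) (B : ℕ)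
    (φ-adjacent : ∀ i j → i < B → j < B → M (φ i) (φ j) ≢ + 0 → suc i ≡ j ⊎ suc j ≡ i)
    (φ-unit : ∀ i → suc i < B → M (φ i) (φ (suc i)) * M (φ i) (φ (suc i)) ≡ + 1)
    (φ-injective : ∀ i j → i < B → j < B → φ i ≡ φ j → i ≡ j) where

    -- The principal submatrix on the segment φ t, …, φ (t + L - 1) is a signed path;
    -- peeling off its pendant end φ t together with φ (t + 1) lowers L by two.
    det-path : ∀ L t → t ℕ.+ L ≤ B → (g : Fin L → Fin K) → (∀ a b → g a ≡ g b → a ≡ b) →
      (∀ a → Σ ℕ λ i → t ≤ i × i < t ℕ.+ L × g a ≡ φ i) →
      (∀ i → t ≤ i → i < t ℕ.+ L → Σ (Fin L) λ a → g a ≡ φ i) →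
      det (λ r c → M (g r) (g c)) ≡ pathDet L
    det-path zero t _ g _ _ _ = refl
    det-path (suc zero) t t+1≤B g _ g-into _ with M (g zero) (g zero) ≟ + 0 | g-into zero
    ... | yes e | _ rewrite e = refl
    ... | no ne | i , _ , i<t+1 , gi with φ-adjacent i i (<-≤-trans i<t+1 t+1≤B) (<-≤-trans i<t+1 t+1≤B)
                                             (λ e → ne (subst (λ z → M z z ≡ + 0) (sym gi) e))
    ...   | inj₁ e = ⊥-elim (1+n≢n e)
    ...   | inj₂ e = ⊥-elim (1+n≢n e)
    det-path (suc (suc L)) t t+L≤B g g-injective g-into g-onto =
      trans (det-pendant (λ r c → M (g r) (g c)) (λ i j → M-sym (g i) (g j)) a b a≢b row-a unit-ab)
            (cong -_ (det-path L (suc (suc t)) t′+L≤B g′ g′-injective g′-into g′-onto))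
      where
      shift : t ℕ.+ suc (suc L) ≡ suc (suc t) ℕ.+ L
      shift = trans (+-suc t (suc L)) (cong suc (+-suc t L))
      t<t+L : t < t ℕ.+ suc (suc L)
      t<t+L = m<m+n t (s≤s z≤n)
      t+1<t+L : suc t < t ℕ.+ suc (suc L)
      t+1<t+L = subst (suc t <_) (sym (+-suc t (suc L))) (s≤s (m<m+n t (s≤s z≤n)))
      inB : ∀ {i} → i < t ℕ.+ suc (suc L) → i < B
      inB i< = <-≤-trans i< t+L≤B
      aP = g-onto t ≤-refl t<t+L
      bP = g-onto (suc t) (n≤1+n t) t+1<t+L
      a = proj₁ aP
      b = proj₁ bP
      a≢b : a ≢ b
      a≢b e = 1+n≢n (sym (φ-injective t (suc t) (inB t<t+L) (inB t+1<t+L)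
                             (trans (sym (proj₂ aP)) (trans (cong g e) (proj₂ bP)))))
      row-a : ∀ j → j ≢ b → M (g a) (g j) ≡ + 0
      row-a j j≢b with M (g a) (g j) ≟ + 0
      ... | yes e = e
      ... | no ne with g-into j
      ...   | i , t≤i , i< , gj with φ-adjacent t i (inB t<t+L) (inB i<)
                                       (λ e → ne (subst₂ (λ x y → M x y ≡ + 0) (sym (proj₂ aP)) (sym gj) e))
      ...     | inj₁ e = ⊥-elim (j≢b (g-injective j b (trans gj (trans (cong φ (sym e)) (sym (proj₂ bP))))))
      ...     | inj₂ e = ⊥-elim (<-irrefl refl (<-≤-trans (subst (i <_) e (n<1+n i)) t≤i))
      unit-ab : M (g a) (g b) * M (g a) (g b) ≡ + 1
      unit-ab rewrite proj₂ aP | proj₂ bP = φ-unit t (inB t+1<t+L)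
      t′+L≤B : suc (suc t) ℕ.+ L ≤ B
      t′+L≤B = subst (_≤ B) shift t+L≤B
      g′ : Fin L → Fin K
      g′ c = g (punchIn₂ a b c)
      g′-injective : ∀ c d → g′ c ≡ g′ d → c ≡ d
      g′-injective c d e = punchIn₂-injective a b c d (g-injective _ _ e)
      g′-into : ∀ c → Σ ℕ λ i → suc (suc t) ≤ i × i < suc (suc t) ℕ.+ L × g′ c ≡ φ i
      g′-into c with g-into (punchIn₂ a b c)
      ... | i , t≤i , i< , gi = i , t+2≤i , subst (i <_) shift i< , gi
        where
        i≢t : i ≢ t
        i≢t e = punchIn₂≢ˡ a b c (g-injective _ _ (trans gi (trans (cong φ e) (sym (proj₂ aP)))))
        i≢t+1 : i ≢ suc t
        i≢t+1 e = punchIn₂≢ʳ a b a≢b c (g-injective _ _ (trans gi (trans (cong φ e) (sym (proj₂ bP)))))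
        t+2≤i : suc (suc t) ≤ i
        t+2≤i with m≤n⇒m<n∨m≡n t≤i
        ... | inj₂ e = ⊥-elim (i≢t (sym e))
        ... | inj₁ t<i with m≤n⇒m<n∨m≡n t<i
        ...   | inj₂ e = ⊥-elim (i≢t+1 (sym e))
        ...   | inj₁ t+1<i = t+1<i
      g′-onto : ∀ i → suc (suc t) ≤ i → i < suc (suc t) ℕ.+ L → Σ (Fin L) λ c → g′ c ≡ φ i
      g′-onto i t+2≤i i< with g-onto i (≤-trans (n≤1+n t) (≤-trans (n≤1+n (suc t)) t+2≤i)) (subst (i <_) (sym shift) i<)
      ... | x , gx = proj₁ cP , trans (cong g (proj₂ cP)) gx
        where
        i<B : i < B
        i<B = inB (subst (i <_) (sym shift) i<)
        x≢a : x ≢ a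
        x≢a e with φ-injective t i (inB t<t+L) i<B (trans (sym (proj₂ aP)) (trans (cong g (sym e)) gx))
        ... | refl = <-irrefl refl (≤-trans (n≤1+n (suc t)) t+2≤i)
        x≢b : x ≢ b
        x≢b e with φ-injective (suc t) i (inB t+1<t+L) i<B (trans (sym (proj₂ bP)) (trans (cong g (sym e)) gx))
        ... | refl = <-irrefl refl t+2≤i
        cP = punchIn₂-surjective a b a≢b x x≢a x≢b

module Matchings where

  open Determinant using (punchIn₂; punchIn₂≢ˡ; punchIn₂≢ʳ; punchIn₂-injective; punchIn₂-surjective; punchIn₂-cases)
  open import Data.Nat using (suc)
  open import Data.Fin using (Fin; zero; suc; _≟_)
  open import Data.Product using (Σ; _,_; proj₁; proj₂)
  open import Data.Sum using (inj₁; inj₂)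
  open import Relation.Binary.PropositionalEquality
  open import Relation.Nullary using (¬_; yes; no)
  open import Data.Empty using (⊥-elim)
  open import Function using (_∘_)
  open PerfectMatching

  perfectMatching-cong : ∀ {k} {M N : Matrix k} → (∀ i j → M i j ≡ N i j) → PerfectMatching M → PerfectMatching N
  perfectMatching-cong e P = record
    { μ = μ P ; involutive = involutive P ; noFixed = noFixed P
    ; adjacent = λ i z → adjacent P i (trans (e i (μ P i)) z) }

  isolated⇒noPerfectMatching : ∀ {k} (M : Matrix k) (u : Fin k) → (∀ j → ¬ Adj M u j) → ¬ PerfectMatching M
  isolated⇒noPerfectMatching M u isolated P = isolated (μ P u) (adjacent P u)

  noPerfectMatching-one : (M : Matrix 1) → ¬ PerfectMatching M
  noPerfectMatching-one M P with μ P zero | noFixed P zero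
  ... | zero | μ0≢0 = μ0≢0 refl

  perfectMatching-zero : (M : Matrix 0) → PerfectMatching M
  perfectMatching-zero M = record { μ = λ () ; involutive = λ () ; noFixed = λ () ; adjacent = λ () }

  perfectMatching-two : (M : Matrix 2) → Adj M zero (suc zero) → Adj M (suc zero) zero → PerfectMatching M
  perfectMatching-two M a₀₁ a₁₀ = record { μ = swap ; involutive = involutive′ ; noFixed = noFixed′ ; adjacent = adjacent′ }
    where
    swap : Fin 2 → Fin 2
    swap zero       = suc zero
    swap (suc zero) = zero
    involutive′ : ∀ i → swap (swap i) ≡ i
    involutive′ zero       = refl
    involutive′ (suc zero) = refl
    noFixed′ : ∀ i → swap i ≢ i
    noFixed′ zero       ()
    noFixed′ (suc zero) ()
    adjacent′ : ∀ i → Adj M i (swap i)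
    adjacent′ zero       = a₀₁
    adjacent′ (suc zero) = a₁₀

  -- A pendant vertex u with unique neighbour w must be matched to w, so perfect matchings
  -- of M correspond to perfect matchings of M with u and w deleted.
  module PendantEdge {k} (M : Matrix (suc (suc k))) (M-sym : ∀ i j → Adj M i j → Adj M j i)
    (u w : Fin (suc (suc k))) (u≢w : u ≢ w) (uw : Adj M u w) (pendant : ∀ j → Adj M u j → j ≡ w) where

    M′ : Matrix k
    M′ r c = M (punchIn₂ u w r) (punchIn₂ u w c)

    restrict : PerfectMatching M → PerfectMatching M′
    restrict P = record { μ = μ′ ; involutive = involutive′ ; noFixed = noFixed′ ; adjacent = adjacent′ }
      where
      μu : μ P u ≡ w
      μu = pendant (μ P u) (adjacent P u)
      μw : μ P w ≡ u
      μw = trans (cong (μ P) (sym μu)) (involutive P u)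
      avoids-u : ∀ c → μ P (punchIn₂ u w c) ≢ u
      avoids-u c e = punchIn₂≢ʳ u w u≢w c (trans (sym (involutive P _)) (trans (cong (μ P) e) μu))
      avoids-w : ∀ c → μ P (punchIn₂ u w c) ≢ w
      avoids-w c e = punchIn₂≢ˡ u w c (trans (sym (involutive P _)) (trans (cong (μ P) e) μw))
      preimage : ∀ c → Σ (Fin k) λ d → punchIn₂ u w d ≡ μ P (punchIn₂ u w c)
      preimage c = punchIn₂-surjective u w u≢w _ (avoids-u c) (avoids-w c)
      μ′ : Fin k → Fin k
      μ′ c = proj₁ (preimage c)
      μ′-spec : ∀ c → punchIn₂ u w (μ′ c) ≡ μ P (punchIn₂ u w c)
      μ′-spec c = proj₂ (preimage c)
      involutive′ : ∀ c → μ′ (μ′ c) ≡ c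
      involutive′ c = punchIn₂-injective u w _ _
        (trans (μ′-spec (μ′ c)) (trans (cong (μ P) (μ′-spec c)) (involutive P _)))
      noFixed′ : ∀ c → μ′ c ≢ c
      noFixed′ c e = noFixed P (punchIn₂ u w c) (trans (sym (μ′-spec c)) (cong (punchIn₂ u w) e))
      adjacent′ : ∀ c → Adj M′ c (μ′ c)
      adjacent′ c z = adjacent P (punchIn₂ u w c) (trans (cong (M (punchIn₂ u w c)) (sym (μ′-spec c))) z)

    extend : PerfectMatching M′ → PerfectMatching M
    extend P = record { μ = ν ; involutive = involutive′ ; noFixed = noFixed′ ; adjacent = adjacent′ }
      where
      ν : Fin (suc (suc k)) → Fin (suc (suc k))
      ν x with x ≟ u | x ≟ w
      ... | yes _ | _     = w
      ... | no _  | yes _ = u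
      ... | no x≢u | no x≢w = punchIn₂ u w (μ P (proj₁ (punchIn₂-surjective u w u≢w x x≢u x≢w)))
      ν-u : ν u ≡ w
      ν-u with u ≟ u
      ... | yes _ = refl
      ... | no u≢u = ⊥-elim (u≢u refl)
      ν-w : ν w ≡ u
      ν-w with w ≟ u | w ≟ w
      ... | yes e | _     = ⊥-elim (u≢w (sym e))
      ... | no _  | yes _ = refl
      ... | no _  | no w≢w = ⊥-elim (w≢w refl)
      ν-punchIn₂ : ∀ c → ν (punchIn₂ u w c) ≡ punchIn₂ u w (μ P c)
      ν-punchIn₂ c with punchIn₂ u w c ≟ u | punchIn₂ u w c ≟ w
      ... | yes e | _     = ⊥-elim (punchIn₂≢ˡ u w c e)
      ... | no _  | yes e = ⊥-elim (punchIn₂≢ʳ u w u≢w c e)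
      ... | no x≢u | no x≢w =
        cong (punchIn₂ u w ∘ μ P) (punchIn₂-injective u w _ _ (proj₂ (punchIn₂-surjective u w u≢w _ x≢u x≢w)))
      involutive′ : ∀ x → ν (ν x) ≡ x
      involutive′ x with punchIn₂-cases u w u≢w x
      ... | inj₁ refl = trans (cong ν ν-u) ν-w
      ... | inj₂ (inj₁ refl) = trans (cong ν ν-w) ν-u
      ... | inj₂ (inj₂ (c , refl)) =
        trans (cong ν (ν-punchIn₂ c)) (trans (ν-punchIn₂ (μ P c)) (cong (punchIn₂ u w) (involutive P c)))
      noFixed′ : ∀ x → ν x ≢ x
      noFixed′ x with punchIn₂-cases u w u≢w x
      ... | inj₁ refl = λ e → u≢w (trans (sym e) ν-u)
      ... | inj₂ (inj₁ refl) = λ e → u≢w (trans (sym ν-w) e)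
      ... | inj₂ (inj₂ (c , refl)) = λ e → noFixed P c (punchIn₂-injective u w _ _ (trans (sym (ν-punchIn₂ c)) e))
      adjacent′ : ∀ x → Adj M x (ν x)
      adjacent′ x with punchIn₂-cases u w u≢w x
      ... | inj₁ refl = λ z → uw (trans (cong (M u) (sym ν-u)) z)
      ... | inj₂ (inj₁ refl) = λ z → M-sym u w uw (trans (cong (M w) (sym ν-w)) z)
      ... | inj₂ (inj₂ (c , refl)) = λ z → adjacent P c (trans (cong (M (punchIn₂ u w c)) (sym (ν-punchIn₂ c))) z)

module Trees where

  open import Data.Nat as ℕ using (ℕ; zero; suc; _≤_; _<_; z≤n; s≤s)
  open import Data.Nat.Properties as ℕP using (≤-trans; m≤m+n; +-assoc)
  open import Data.Nat.Tactic.RingSolver using (solve-∀)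
  open import Data.Integer using (ℤ; +_; -[1+_])
  open import Data.Integer.Properties using () renaming (_≟_ to _≟ℤ_)
  open import Data.Fin using (Fin; zero; suc; punchIn; punchOut; _≟_)
  open import Data.Fin.Properties using (punchIn-punchOut; punchInᵢ≢i; punchIn-injective; punchOut-punchIn; any?)
  open import Data.Product using (Σ; _,_; proj₁; proj₂; _×_)
  open import Data.Sum using (_⊎_; inj₁; inj₂)
  open import Relation.Binary.PropositionalEquality
  open import Relation.Binary.Construct.Closure.ReflexiveTransitive using (Star; ε; _◅_)
  open import Relation.Nullary using (¬_; yes; no)
  open import Relation.Nullary.Decidable using (¬?; _×-dec_)
  open import Data.Empty using (⊥-elim)

  private
    sumFinℕ-extract : ∀ {k} (a : Fin (suc k)) (f : Fin (suc k) → ℕ) →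
      sumFinℕ f ≡ f a ℕ.+ sumFinℕ (λ b → f (punchIn a b))
    sumFinℕ-extract zero f = refl
    sumFinℕ-extract {suc k} (suc a) f rewrite sumFinℕ-extract a (λ i → f (suc i)) =
      left-comm (f zero) (f (suc a)) (sumFinℕ (λ b → f (suc (punchIn a b))))
      where
      left-comm : ∀ x y z → x ℕ.+ (y ℕ.+ z) ≡ y ℕ.+ (x ℕ.+ z)
      left-comm = solve-∀

    sumFinℕ-cong : ∀ {k} {f g : Fin k → ℕ} → (∀ i → f i ≡ g i) → sumFinℕ f ≡ sumFinℕ g
    sumFinℕ-cong {zero}  e = refl
    sumFinℕ-cong {suc k} e = cong₂ ℕ._+_ (e zero) (sumFinℕ-cong (λ i → e (suc i)))

    sumFinℕ-lowerBound : ∀ {k} (f : Fin k → ℕ) (c : ℕ) → (∀ i → c ≤ f i) → k ℕ.* c ≤ sumFinℕ f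
    sumFinℕ-lowerBound {zero}  f c h = z≤n
    sumFinℕ-lowerBound {suc k} f c h = ℕP.+-mono-≤ (h zero) (sumFinℕ-lowerBound (λ i → f (suc i)) c (λ i → h (suc i)))

    term≤sumFinℕ : ∀ {k} (f : Fin k → ℕ) a → f a ≤ sumFinℕ f
    term≤sumFinℕ {suc k} f a = subst (f a ≤_) (sym (sumFinℕ-extract a f)) (m≤m+n (f a) _)

    twoTerms≤sumFinℕ : ∀ {k} (f : Fin k → ℕ) a b → a ≢ b → f a ℕ.+ f b ≤ sumFinℕ f
    twoTerms≤sumFinℕ {suc k} f a b a≢b = subst (f a ℕ.+ f b ≤_) (sym (sumFinℕ-extract a f))
      (ℕP.+-monoʳ-≤ (f a) (subst (λ x → f x ≤ _) (punchIn-punchOut a≢b) (term≤sumFinℕ (λ c → f (punchIn a c)) (punchOut a≢b))))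

    sumFinℕ-zero : ∀ {k} {f : Fin k → ℕ} → (∀ i → f i ≡ 0) → sumFinℕ f ≡ 0
    sumFinℕ-zero {zero}  e = refl
    sumFinℕ-zero {suc k} e rewrite e zero = sumFinℕ-zero (λ i → e (suc i))

    sumFinℕ-+ : ∀ {k} (f g : Fin k → ℕ) → sumFinℕ (λ i → f i ℕ.+ g i) ≡ sumFinℕ f ℕ.+ sumFinℕ g
    sumFinℕ-+ {zero}  f g = refl
    sumFinℕ-+ {suc k} f g rewrite sumFinℕ-+ (λ i → f (suc i)) (λ i → g (suc i)) =
      interchange (f zero) (g zero) _ _
      where
      interchange : ∀ a b c d → a ℕ.+ b ℕ.+ (c ℕ.+ d) ≡ a ℕ.+ c ℕ.+ (b ℕ.+ d)
      interchange = solve-∀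

    isEdgeℕ-nonzero : ∀ (x : ℤ) → x ≢ + 0 → isEdgeℕ x ≡ 1
    isEdgeℕ-nonzero (+ zero)    x≢0 = ⊥-elim (x≢0 refl)
    isEdgeℕ-nonzero (+ suc n)   x≢0 = refl
    isEdgeℕ-nonzero -[1+ n ]   x≢0 = refl

    isEdgeℕ-nonAdj : ∀ {k} (T : Matrix k) i j → ¬ Adj T i j → isEdgeℕ (T i j) ≡ 0
    isEdgeℕ-nonAdj T i j ¬adj with T i j ≟ℤ + 0
    ... | yes e = cong isEdgeℕ e
    ... | no ne = ⊥-elim (¬adj ne)

  degree : ∀ {m} → Matrix m → Fin m → ℕ
  degree T i = sumFinℕ (λ j → isEdgeℕ (T i j))

  AtMostOneNeighbour : ∀ {m} → Matrix m → Fin m → Set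
  AtMostOneNeighbour T u = ∀ j j′ → Adj T u j → Adj T u j′ → j ≡ j′

  degree≤1⇒atMostOneNeighbour : ∀ {m} (T : Matrix m) u → degree T u ≤ 1 → AtMostOneNeighbour T u
  degree≤1⇒atMostOneNeighbour T u deg≤1 j j′ a a′ with j ≟ j′
  ... | yes e = e
  ... | no j≢j′ = ⊥-elim (ℕP.<-irrefl refl (ℕP.<-≤-trans (s≤s (s≤s z≤n)) (≤-trans (≤-trans
        (ℕP.≤-reflexive (cong₂ ℕ._+_ (sym (isEdgeℕ-nonzero _ a)) (sym (isEdgeℕ-nonzero _ a′))))
        (twoTerms≤sumFinℕ (λ k → isEdgeℕ (T u k)) j j′ j≢j′)) deg≤1)))

  connected⇒neighbour : ∀ {m} (T : Matrix (suc (suc m))) → Connected T → ∀ u → Σ (Fin (suc (suc m))) λ w → Adj T u w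
  connected⇒neighbour T C u = firstStep (C u (other u)) (other≢ u)
    where
    other : ∀ {m} → Fin (suc (suc m)) → Fin (suc (suc m))
    other zero    = suc zero
    other (suc _) = zero
    other≢ : ∀ {m} (u : Fin (suc (suc m))) → u ≢ other u
    other≢ zero    ()
    other≢ (suc u) ()
    firstStep : ∀ {x} → Star (Adj T) u x → u ≢ x → Σ _ λ w → Adj T u w
    firstStep ε             u≢u = ⊥-elim (u≢u refl)
    firstStep (_◅_ {j = j} a _) _ = j , a

  degree≥1 : ∀ {m} (T : Matrix (suc (suc m))) → Connected T → ∀ u → 1 ≤ degree T u
  degree≥1 T C u with connected⇒neighbour T C u
  ... | w , a = ≤-trans (ℕP.≤-reflexive (sym (isEdgeℕ-nonzero _ a))) (term≤sumFinℕ (λ j → isEdgeℕ (T u j)) w)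

  -- Deleting a vertex u with at most one neighbour from a connected graph on at least two
  -- vertices: walks survive by contracting u onto its neighbour w, and exactly 2 ordered edges are lost.
  module DeleteLeaf {m} (T : Matrix (suc (suc m))) (SG : IsSignedGraph T) (C : Connected T)
    (u : Fin (suc (suc m))) (leaf : AtMostOneNeighbour T u) where
    open IsSignedGraph SG

    T′ : Matrix (suc m)
    T′ = induced T (punchIn u)

    T′-signedGraph : IsSignedGraph T′
    T′-signedGraph = record { symmetric = λ i j → symmetric _ _ ; loopless = λ i → loopless _ ; entries = λ i j → entries _ _ }

    private
      w : Fin (suc (suc m))
      w = proj₁ (connected⇒neighbour T C u)
      uw : Adj T u w
      uw = proj₂ (connected⇒neighbour T C u)
      u≢w : u ≢ w
      u≢w e = uw (trans (cong (T u) (sym e)) (loopless u))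

      contract : Fin (suc (suc m)) → Fin (suc (suc m))
      contract x with x ≟ u
      ... | yes _ = w
      ... | no _  = x
      u≢contract : ∀ x → u ≢ contract x
      u≢contract x with x ≟ u
      ... | yes _ = u≢w
      ... | no x≢u = λ e → x≢u (sym e)
      contract-u : contract u ≡ w
      contract-u with u ≟ u
      ... | yes _ = refl
      ... | no u≢u = ⊥-elim (u≢u refl)
      contract-≢u : ∀ x → x ≢ u → contract x ≡ x
      contract-≢u x x≢u with x ≟ u
      ... | yes e = ⊥-elim (x≢u e)
      ... | no _  = refl

      project : Fin (suc (suc m)) → Fin (suc m)
      project x = punchOut (u≢contract x)
      project-punchIn : ∀ c → project (punchIn u c) ≡ c
      project-punchIn c with punchIn u c ≟ u
      ... | yes e = ⊥-elim (punchInᵢ≢i u c e)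
      ... | no _  = punchOut-punchIn u
      punchIn-project : ∀ x → punchIn u (project x) ≡ contract x
      punchIn-project x = punchIn-punchOut (u≢contract x)

      project-cong : ∀ x y → contract x ≡ contract y → project x ≡ project y
      project-cong x y e = punchIn-injective u _ _ (trans (punchIn-project x) (trans e (sym (punchIn-project y))))

      isU? : ∀ x → x ≡ u ⊎ x ≢ u
      isU? x with x ≟ u
      ... | yes e   = inj₁ e
      ... | no x≢u = inj₂ x≢u

      project-edge : ∀ {x y} → Adj T x y → project x ≡ project y ⊎ Adj T′ (project x) (project y)
      project-edge {x} {y} a with isU? x | isU? y
      ... | inj₁ refl | _ = inj₁ (project-cong x y (trans contract-u (sym (trans (contract-≢u y y≢u) y≡w))))
        where
        y≡w : y ≡ w
        y≡w = leaf y w a uw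
        y≢u : y ≢ u
        y≢u e = u≢w (trans (sym e) y≡w)
      ... | inj₂ x≢u | inj₁ refl = inj₁ (project-cong x y (trans (trans (contract-≢u x x≢u) x≡w) (sym contract-u)))
        where
        x≡w : x ≡ w
        x≡w = leaf x w (λ e → a (trans (symmetric x u) e)) uw
      ... | inj₂ x≢u | inj₂ y≢u = inj₂ λ z → a (trans (sym (cong₂ T (trans (punchIn-project x) (contract-≢u x x≢u))
                                                                  (trans (punchIn-project y) (contract-≢u y y≢u)))) z)

      project-walk : ∀ {x y} → Star (Adj T) x y → Star (Adj T′) (project x) (project y)
      project-walk ε = ε
      project-walk {y = y} (a ◅ rest) with project-edge a
      ... | inj₁ e  = subst (λ z → Star (Adj T′) z (project y)) (sym e) (project-walk rest)
      ... | inj₂ a′ = a′ ◅ project-walk rest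

      E : Fin (suc (suc m)) → Fin (suc (suc m)) → ℕ
      E i j = isEdgeℕ (T i j)

      degree-u : degree T u ≡ 1
      degree-u = trans (sumFinℕ-extract w (E u)) (cong₂ ℕ._+_ (isEdgeℕ-nonzero _ uw)
        (sumFinℕ-zero (λ j → isEdgeℕ-nonAdj T u (punchIn w j) (λ a → punchInᵢ≢i w j (leaf _ w a uw)))))

      column-u : sumFinℕ (λ i → E (punchIn u i) u) ≡ degree T u
      column-u = trans (sumFinℕ-cong (λ i → cong isEdgeℕ (symmetric (punchIn u i) u)))
        (sym (trans (sumFinℕ-extract u (E u)) (cong (λ z → z ℕ.+ sumFinℕ (λ i → E u (punchIn u i))) (cong isEdgeℕ (loopless u)))))

      edgeCount-delete : orderedEdgeCount T ≡ degree T u ℕ.+ degree T u ℕ.+ orderedEdgeCount T′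
      edgeCount-delete = trans (sumFinℕ-extract u (degree T))
        (trans (cong (degree T u ℕ.+_) (trans (sumFinℕ-cong (λ i → sumFinℕ-extract u (E (punchIn u i))))
           (trans (sumFinℕ-+ (λ i → E (punchIn u i) u) (λ i → sumFinℕ (λ j → E (punchIn u i) (punchIn u j))))
             (cong (ℕ._+ orderedEdgeCount T′) column-u))))
           (sym (+-assoc (degree T u) (degree T u) _)))

    T′-tree : IsTree T → IsTree T′
    T′-tree (_ , count) =
      (λ i j → subst₂ (Star (Adj T′)) (project-punchIn i) (project-punchIn j) (project-walk (C (punchIn u i) (punchIn u j)))) ,
      ℕP.+-cancelˡ-≡ 2 _ _ (trans (sym (trans edgeCount-delete (cong (λ d → d ℕ.+ d ℕ.+ orderedEdgeCount T′) degree-u)))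
                                  (trans count (ℕP.*-suc 2 m)))

  -- A tree with at least two vertices has at least two leaves, as its degrees sum to 2(m - 1).
  tree-leafAvoiding : ∀ {m} (T : Matrix (suc (suc m))) → IsTree T → ∀ z →
    Σ (Fin (suc (suc m))) λ u → u ≢ z × degree T u ≤ 1
  tree-leafAvoiding {m} T (C , count) z with any? (λ u → ¬? (u ≟ z) ×-dec (degree T u ℕP.≤? 1))
  ... | yes (u , p) = u , p
  ... | no none = ⊥-elim (ℕP.<-irrefl refl (ℕP.<-≤-trans too-many (ℕP.≤-reflexive count)))
    where
    degree≥2 : ∀ u → 2 ≤ degree T (punchIn z u)
    degree≥2 u with degree T (punchIn z u) ℕP.≤? 1
    ... | yes le = ⊥-elim (none (punchIn z u , punchInᵢ≢i z u , le))
    ... | no nle = ℕP.≰⇒> nle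
    too-many : 2 ℕ.* suc m < orderedEdgeCount T
    too-many = subst (2 ℕ.* suc m <_) (sym (sumFinℕ-extract z (degree T)))
       (ℕP.<-≤-trans (subst (_< suc (suc m ℕ.* 2)) (ℕP.*-comm (suc m) 2) (ℕP.n<1+n _))
          (ℕP.+-mono-≤ (degree≥1 T C z) (sumFinℕ-lowerBound (λ u → degree T (punchIn z u)) 2 degree≥2)))

  atMostOneNeighbour-cong : ∀ {k} {M N : Matrix k} → (∀ i j → M i j ≡ N i j) →
    ∀ a → AtMostOneNeighbour M a → AtMostOneNeighbour N a
  atMostOneNeighbour-cong e a one j j′ x y = one j j′ (λ z → x (trans (sym (e a j)) z)) (λ z → y (trans (sym (e a j′)) z))

  HasInducedLeaves : ∀ {m} → Matrix m → Set
  HasInducedLeaves {m} T = ∀ {k} (f : Fin k → Fin m) → (∀ a b → f a ≡ f b → a ≡ b) → Fin k → ∀ z →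
    (Σ (Fin k) λ a → f a ≢ z × AtMostOneNeighbour (induced T f) a) ⊎ (∀ a → f a ≡ z)

  private
    -- A leaf u ≠ z of T either lies in the image of f, where it is still a leaf, or can be deleted from T.
    hasInducedLeaves-step : ∀ m → (∀ (T : Matrix (suc m)) → IsSignedGraph T → IsTree T → HasInducedLeaves T) →
      ∀ (T : Matrix (suc (suc m))) → IsSignedGraph T → IsTree T → HasInducedLeaves T
    hasInducedLeaves-step m IH T SG TR f f-injective a₀ z with tree-leafAvoiding T TR z
    ... | u , u≢z , deg≤1 with any? (λ a → f a ≟ u)
    ...   | yes (a , fa≡u) = inj₁ (a , (λ e → u≢z (trans (sym fa≡u) e)) , leafInImage)
      where
      leaf : AtMostOneNeighbour T u
      leaf = degree≤1⇒atMostOneNeighbour T u deg≤1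
      leafInImage : AtMostOneNeighbour (induced T f) a
      leafInImage j j′ x y = f-injective j j′ (leaf (f j) (f j′)
        (λ q → x (subst (λ t → T t (f j) ≡ + 0) (sym fa≡u) q)) (λ q → y (subst (λ t → T t (f j′) ≡ + 0) (sym fa≡u) q)))
    ...   | no u∉f = lift (IH D.T′ D.T′-signedGraph (D.T′-tree TR) g g-injective a₀ z′)
      where
      module D = DeleteLeaf T SG (proj₁ TR) u (degree≤1⇒atMostOneNeighbour T u deg≤1)
      u≢f : ∀ a → u ≢ f a
      u≢f a e = u∉f (a , sym e)
      g : _ → Fin (suc m)
      g a = punchOut (u≢f a)
      punchIn-g : ∀ a → punchIn u (g a) ≡ f a
      punchIn-g a = punchIn-punchOut (u≢f a)
      g-injective : ∀ a b → g a ≡ g b → a ≡ b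
      g-injective a b e = f-injective a b (trans (sym (punchIn-g a)) (trans (cong (punchIn u) e) (punchIn-g b)))
      z′ = punchOut u≢z
      punchIn-z′ : punchIn u z′ ≡ z
      punchIn-z′ = punchIn-punchOut u≢z
      lift : _ → _
      lift (inj₁ (a , ga≢z′ , one)) =
        inj₁ (a , (λ e → ga≢z′ (punchIn-injective u _ _ (trans (punchIn-g a) (trans e (sym punchIn-z′))))) ,
              atMostOneNeighbour-cong (λ i j → cong₂ T (punchIn-g i) (punchIn-g j)) a one)
      lift (inj₂ all) = inj₂ (λ a → trans (sym (punchIn-g a)) (trans (cong (punchIn u) (all a)) punchIn-z′))

  tree-hasInducedLeaves : ∀ m (T : Matrix m) → IsSignedGraph T → IsTree T → HasInducedLeaves T
  tree-hasInducedLeaves zero          T _ _ f _ a₀ z with f a₀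
  ... | ()
  tree-hasInducedLeaves (suc zero)    T _ _ f _ _ zero = inj₂ λ a → single (f a)
    where
    single : ∀ (x : Fin 1) → x ≡ zero
    single zero = refl
  tree-hasInducedLeaves (suc (suc m)) T = hasInducedLeaves-step m (tree-hasInducedLeaves (suc m)) T

module Cycle where

  open import Data.Nat as ℕ using (ℕ; suc; _≤_; _<_; z≤n; s≤s; _≡ᵇ_; _∸_; _%_)
  open import Data.Nat.Properties as ℕP
    using (≡ᵇ⇒≡; ≡⇒≡ᵇ; _<?_; <-cmp; ≤-total; ≤-trans; ≤-<-trans; <-≤-trans; ≤-pred; <-irrefl; ≮⇒≥; n≤1+n;
           +-cancelˡ-≡; +-cancelʳ-<; +-cancelˡ-<; +-identityʳ; +-assoc; +-suc; +-mono-<; +-monoˡ-<; 1+n≢0;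
           m∸n+n≡m; m+[n∸m]≡n; m∸n≤m; ∸-monoʳ-<; m≤n+m; m≤n⇒m<n∨m≡n)
  open import Data.Nat.DivMod using (m%n<n; m<n⇒m%n≡m; %-distribˡ-+; [m+n]%n≡m%n; n%n≡0)
  open import Data.Integer using (+_; -_; _*_)
  open import Data.Fin using (Fin; toℕ; fromℕ<)
  open import Data.Fin.Properties using (toℕ-fromℕ<; toℕ-injective; toℕ<n)
  open import Relation.Binary.Definitions using (tri<; tri≈; tri>)
  open import Data.Bool using (true; false; T; _∨_)
  open import Data.Unit using (tt)
  open import Data.Product using (Σ; _,_; _×_)
  open import Data.Sum using (_⊎_; inj₁; inj₂)
  open import Relation.Binary.PropositionalEquality
  open import Relation.Nullary using (¬_; yes; no)
  open import Data.Empty using (⊥-elim; ⊥)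

  ≡ᵇ-true⇒≡ : ∀ a b → (a ≡ᵇ b) ≡ true → a ≡ b
  ≡ᵇ-true⇒≡ a b e = ≡ᵇ⇒≡ a b (subst T (sym e) tt)

  ≡⇒≡ᵇ-true : ∀ a b → a ≡ b → (a ≡ᵇ b) ≡ true
  ≡⇒≡ᵇ-true a b e = T-true (≡⇒≡ᵇ a b e)
    where
    T-true : ∀ {x} → T x → x ≡ true
    T-true {true} _ = refl

  ≢⇒≡ᵇ-false : ∀ a b → a ≢ b → (a ≡ᵇ b) ≡ false
  ≢⇒≡ᵇ-false a b a≢b with a ≡ᵇ b in e
  ... | true  = ⊥-elim (a≢b (≡ᵇ-true⇒≡ a b e))
  ... | false = refl

  next?-sound : ∀ n (a b : Fin n) → next? n a b ≡ true → suc (toℕ a) ≡ toℕ b ⊎ (suc (toℕ a) ≡ n × toℕ b ≡ 0)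
  next?-sound n a b e with suc (toℕ a) ≡ᵇ toℕ b in e₁
  ... | true = inj₁ (≡ᵇ-true⇒≡ _ _ e₁)
  ... | false with suc (toℕ a) ≡ᵇ n in e₂ | toℕ b ≡ᵇ 0 in e₃
  ...   | true  | true  = inj₂ (≡ᵇ-true⇒≡ _ _ e₂ , ≡ᵇ-true⇒≡ _ _ e₃)
  ...   | true  | false with () ← e
  ...   | false | _     with () ← e

  next?-step : ∀ n (a b : Fin n) → suc (toℕ a) ≡ toℕ b → next? n a b ≡ true
  next?-step n a b e rewrite ≡⇒≡ᵇ-true _ _ e = refl

  next?-wrap : ∀ n (a b : Fin n) → suc (toℕ a) ≡ n → toℕ b ≡ 0 → next? n a b ≡ true
  next?-wrap n a b e₁ e₂ rewrite ≡⇒≡ᵇ-true _ _ e₁ | ≡⇒≡ᵇ-true _ _ e₂ = ∨-true _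
    where
    ∨-true : ∀ x → (x ∨ true) ≡ true
    ∨-true true  = refl
    ∨-true false = refl

  private
    3≰1 : ¬ (3 ≤ 1)
    3≰1 (s≤s ())
    3≰2 : ¬ (3 ≤ 2)
    3≰2 (s≤s (s≤s ()))

  -- Only for n ≥ 3 are the two orientations of a cycle edge distinguishable.
  next?-antisym : ∀ n → 3 ≤ n → (a b : Fin n) → next? n a b ≡ true → next? n b a ≡ true → ⊥
  next?-antisym n 3≤n a b e₁ e₂ with next?-sound n a b e₁ | next?-sound n b a e₂
  ... | inj₁ x | inj₁ y = ℕP.<-irrefl refl (subst (toℕ a <_) (trans (cong suc x) y) (ℕP.≤-trans (ℕP.n<1+n _) (ℕP.n≤1+n _)))
  ... | inj₁ x | inj₂ (y₁ , y₂) = 3≰2 (subst (3 ≤_) (trans (sym y₁) (cong suc (trans (sym x) (cong suc y₂)))) 3≤n)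
  ... | inj₂ (x₁ , x₂) | inj₁ y = 3≰2 (subst (3 ≤_) (trans (sym x₁) (cong suc (trans (sym y) (cong suc x₂)))) 3≤n)
  ... | inj₂ (x₁ , x₂) | inj₂ (y₁ , y₂) = 3≰1 (subst (3 ≤_) (trans (sym x₁) (cong suc y₂)) 3≤n)

  sgn-unit : ∀ s → sgn s * sgn s ≡ + 1
  sgn-unit pos = refl
  sgn-unit neg = refl

  sgn≢0 : ∀ s → sgn s ≢ + 0
  sgn≢0 pos ()
  sgn≢0 neg ()

  module _ {n : ℕ} (σ : Fin n → Sgn) where

    cycleMatrix-next : ∀ a b → next? n a b ≡ true → cycleMatrix n σ a b ≡ sgn (σ a)
    cycleMatrix-next a b e rewrite e = refl

    cycleMatrix-support : ∀ a b → cycleMatrix n σ a b ≢ + 0 → next? n a b ≡ true ⊎ next? n b a ≡ true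
    cycleMatrix-support a b ne with next? n a b | next? n b a
    ... | true  | _     = inj₁ refl
    ... | false | true  = inj₂ refl
    ... | false | false = ⊥-elim (ne refl)

    cycleMatrix-unit : ∀ a b → cycleMatrix n σ a b ≢ + 0 → cycleMatrix n σ a b * cycleMatrix n σ a b ≡ + 1
    cycleMatrix-unit a b ne with next? n a b | next? n b a
    ... | true  | _     = sgn-unit (σ a)
    ... | false | true  = sgn-unit (σ b)
    ... | false | false = ⊥-elim (ne refl)

    cycleMatrix-sym : 3 ≤ n → ∀ a b → cycleMatrix n σ a b ≡ cycleMatrix n σ b a
    cycleMatrix-sym 3≤n a b with next? n a b in e₁ | next? n b a in e₂
    ... | true  | true  = ⊥-elim (next?-antisym n 3≤n a b e₁ e₂)
    ... | true  | false = refl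
    ... | false | true  = refl
    ... | false | false = refl

  private
    module Mod (N : ℕ) .{{_ : ℕ.NonZero N}} where

      +-%-zero : ∀ x d → d < N → (x ℕ.+ d) % N ≡ x % N → d ≡ 0
      +-%-zero x d d<N e with x % N ℕ.+ d <? N
      ... | yes lt = +-cancelˡ-≡ (x % N) d 0 (trans (sym no-wrap) (trans e (sym (+-identityʳ _))))
        where
        no-wrap : (x ℕ.+ d) % N ≡ x % N ℕ.+ d
        no-wrap = trans (%-distribˡ-+ x d N) (trans (cong (λ z → (x % N ℕ.+ z) % N) (m<n⇒m%n≡m d<N)) (m<n⇒m%n≡m lt))
      ... | no nlt = ⊥-elim (<-irrefl refl (subst (_< N) (sym N≡d) d<N))
        where
        y = x % N
        z = y ℕ.+ d ∸ N
        y+d≡z+N : y ℕ.+ d ≡ z ℕ.+ N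
        y+d≡z+N = sym (m∸n+n≡m (≮⇒≥ nlt))
        z<N : z < N
        z<N = +-cancelʳ-< N z N (subst (_< N ℕ.+ N) y+d≡z+N (+-mono-< (m%n<n x N) d<N))
        wrap : (x ℕ.+ d) % N ≡ z
        wrap = trans (%-distribˡ-+ x d N) (trans (cong (λ t → (y ℕ.+ t) % N) (m<n⇒m%n≡m d<N))
                 (trans (cong (_% N) y+d≡z+N) (trans ([m+n]%n≡m%n z N) (m<n⇒m%n≡m z<N))))
        N≡d : N ≡ d
        N≡d = sym (+-cancelˡ-≡ y d N (trans y+d≡z+N (cong (ℕ._+ N) (trans (sym wrap) e))))

      +-%-cancelˡ : ∀ s a b → a < N → b < N → (s ℕ.+ a) % N ≡ (s ℕ.+ b) % N → a ≡ b
      +-%-cancelˡ s a b a<N b<N e with ≤-total a b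
      ... | inj₁ a≤b = sym (trans (sym (m∸n+n≡m a≤b)) (cong (ℕ._+ a) (+-%-zero (s ℕ.+ a) (b ∸ a) (≤-<-trans (m∸n≤m b a) b<N)
            (trans (cong (_% N) (trans (+-assoc s a (b ∸ a)) (cong (s ℕ.+_) (m+[n∸m]≡n a≤b)))) (sym e)))))
      ... | inj₂ b≤a = trans (sym (m∸n+n≡m b≤a)) (cong (ℕ._+ b) (+-%-zero (s ℕ.+ b) (a ∸ b) (≤-<-trans (m∸n≤m a b) a<N)
            (trans (cong (_% N) (trans (+-assoc s b (a ∸ b)) (cong (s ℕ.+_) (m+[n∸m]≡n b≤a)))) e)))

      suc-% : 1 < N → ∀ x → suc (x % N) % N ≡ suc x % N
      suc-% 1<N x = sym (trans (%-distribˡ-+ 1 x N) (cong (λ t → (t ℕ.+ x % N) % N) (m<n⇒m%n≡m 1<N)))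

  next?⇒≡suc% : ∀ {N} .{{_ : ℕ.NonZero N}} (a b : Fin N) → next? N a b ≡ true → toℕ b ≡ suc (toℕ a) % N
  next?⇒≡suc% {N} a b e with next?-sound N a b e
  ... | inj₁ x       = sym (trans (cong (_% N) x) (m<n⇒m%n≡m (toℕ<n b)))
  ... | inj₂ (x , y) = trans y (sym (trans (cong (_% N) x) (n%n≡0 N)))

  ≡suc%⇒next? : ∀ {N} .{{_ : ℕ.NonZero N}} (a b : Fin N) → toℕ b ≡ suc (toℕ a) % N → next? N a b ≡ true
  ≡suc%⇒next? {N} a b e with m≤n⇒m<n∨m≡n (toℕ<n a)
  ... | inj₁ lt = next?-step N a b (sym (trans e (m<n⇒m%n≡m lt)))
  ... | inj₂ eq = next?-wrap N a b eq (trans e (trans (cong (_% N) eq) (n%n≡0 N)))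

  -- The vertices of the cycle C_(1 + n₁) met when walking from v: vertex i is v + 1 + i (mod 1 + n₁),
  -- so 0, …, n₁ - 1 enumerate the cycle with v deleted, in path order.
  module WalkFrom (n₁ : ℕ) (2≤n₁ : 2 ≤ n₁) (v : Fin (suc n₁)) where
    private
      N = suc n₁
      open Mod N
      1<N : 1 < N
      1<N = s≤s (≤-trans (s≤s z≤n) 2≤n₁)

    walk : ℕ → Fin N
    walk i = fromℕ< (m%n<n (suc (toℕ v) ℕ.+ i) N)

    private
      toℕ-walk : ∀ i → toℕ (walk i) ≡ (suc (toℕ v) ℕ.+ i) % N
      toℕ-walk i = toℕ-fromℕ< _

    walk≢v : ∀ i → i < n₁ → walk i ≢ v
    walk≢v i i<n₁ e = 1+n≢0 (+-%-cancelˡ (toℕ v) (suc i) 0 (s≤s i<n₁) (s≤s z≤n)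
      (trans (cong (_% N) (+-suc (toℕ v) i)) (trans (sym (toℕ-walk i)) (trans (cong toℕ e)
        (sym (trans (cong (_% N) (+-identityʳ (toℕ v))) (m<n⇒m%n≡m (toℕ<n v))))))))

    walk-injective : ∀ i j → i < n₁ → j < n₁ → walk i ≡ walk j → i ≡ j
    walk-injective i j i<n₁ j<n₁ e = +-%-cancelˡ (suc (toℕ v)) i j (≤-trans i<n₁ (n≤1+n n₁)) (≤-trans j<n₁ (n≤1+n n₁))
      (trans (sym (toℕ-walk i)) (trans (cong toℕ e) (toℕ-walk j)))

    walk-surjective : ∀ c → c ≢ v → Σ ℕ λ i → i < n₁ × walk i ≡ c
    walk-surjective c c≢v with <-cmp (toℕ v) (toℕ c)
    ... | tri≈ _ e _ = ⊥-elim (c≢v (toℕ-injective (sym e)))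
    ... | tri< v<c _ _ = i , i<n₁ , toℕ-injective (trans (toℕ-walk i) (trans (cong (_% N) (m+[n∸m]≡n v<c)) (m<n⇒m%n≡m (toℕ<n c))))
      where
      i = toℕ c ∸ suc (toℕ v)
      i<n₁ : i < n₁
      i<n₁ = <-≤-trans (∸-monoʳ-< {toℕ c} {suc (toℕ v)} {0} (s≤s z≤n) v<c) (≤-pred (toℕ<n c))
    ... | tri> _ _ c<v = i , i<n₁ , toℕ-injective (trans (toℕ-walk i) (trans (cong (_% N) v+1+i≡c+N)
                                      (trans ([m+n]%n≡m%n (toℕ c) N) (m<n⇒m%n≡m (toℕ<n c)))))
      where
      i = toℕ c ℕ.+ N ∸ suc (toℕ v)
      v+1+i≡c+N : suc (toℕ v) ℕ.+ i ≡ toℕ c ℕ.+ N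
      v+1+i≡c+N = m+[n∸m]≡n (≤-trans (toℕ<n v) (m≤n+m N (toℕ c)))
      i<n₁ : i < n₁
      i<n₁ = +-cancelˡ-< (suc (toℕ v)) i n₁ (subst (_< suc (toℕ v) ℕ.+ n₁) (sym v+1+i≡c+N)
               (subst (_< suc (toℕ v) ℕ.+ n₁) (sym (+-suc (toℕ c) n₁)) (s≤s (+-monoˡ-< n₁ c<v))))

    walk-next : ∀ i → next? N (walk i) (walk (suc i)) ≡ true
    walk-next i = ≡suc%⇒next? (walk i) (walk (suc i)) (trans (toℕ-walk (suc i))
      (sym (trans (cong (λ t → suc t % N) (toℕ-walk i)) (trans (suc-% 1<N (suc (toℕ v) ℕ.+ i)) (cong (_% N) (sym (+-suc (suc (toℕ v)) i)))))))

    walk-next⇒suc : ∀ i j → i < n₁ → j < n₁ → next? N (walk i) (walk j) ≡ true → suc i ≡ j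
    walk-next⇒suc i j i<n₁ j<n₁ e = +-%-cancelˡ (suc (toℕ v)) (suc i) j (s≤s i<n₁) (≤-trans j<n₁ (n≤1+n n₁))
      (trans (cong (_% N) (+-suc (suc (toℕ v)) i)) (trans (sym (suc-% 1<N (suc (toℕ v) ℕ.+ i)))
        (trans (cong (λ t → suc t % N) (sym (toℕ-walk i))) (trans (sym (next?⇒≡suc% _ _ e)) (toℕ-walk j)))))

module CycleDeterminant where

  open FiniteSums
  open Determinant
  open SignedPath
  open Cycle using (≡ᵇ-true⇒≡; ≡⇒≡ᵇ-true; ≢⇒≡ᵇ-false; sgn-unit)
  open import Data.Nat as ℕ using (ℕ; zero; suc; _≤_; _<_; s≤s; z≤n; _≡ᵇ_)
  import Data.Nat.Properties as ℕP
  open import Data.Integer using (ℤ; +_; -_; _*_; _+_)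
  import Data.Integer.Properties as ℤP
  open import Data.Integer.Tactic.RingSolver using (solve-∀)
  open import Data.Fin using (Fin; zero; suc; toℕ; punchIn; fromℕ; inject₁)
  open import Data.Fin.Properties using (toℕ-fromℕ; toℕ-inject₁; toℕ<n; toℕ-injective; inject₁-injective; suc-injective)
  open import Data.Bool using (Bool; true; false; if_then_else_)
  open import Relation.Binary.PropositionalEquality
  open import Data.Empty using (⊥-elim)
  open import Data.Product using (Σ; _,_)
  open import Data.Sum using (_⊎_; inj₁; inj₂)
  open import Function using (_∘_)

  private
    false≢true : false ≢ true
    false≢true ()

    punchIn-last : ∀ {K} (r : Fin K) → punchIn (fromℕ K) r ≡ inject₁ r
    punchIn-last zero    = refl
    punchIn-last (suc r) = cong suc (punchIn-last r)

    toFin : ∀ K → ℕ → Fin (suc K)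
    toFin zero    _       = zero
    toFin (suc K) zero    = zero
    toFin (suc K) (suc i) = suc (toFin K i)

    toℕ-toFin : ∀ K i → i ≤ K → toℕ (toFin K i) ≡ i
    toℕ-toFin zero    zero    _         = refl
    toℕ-toFin (suc K) zero    _         = refl
    toℕ-toFin (suc K) (suc i) (s≤s i≤K) = cong suc (toℕ-toFin K i i≤K)

    2+c≢r : ∀ {r c} → r ℕ.< c → suc (suc c) ≢ r
    2+c≢r {r} {c} lt e = ℕP.<-asym lt (subst (c ℕ.<_) e (ℕP.≤-trans (ℕP.n<1+n c) (ℕP.n≤1+n _)))

    2+r≢r : ∀ r → suc (suc r) ≢ r
    2+r≢r r e = ℕP.<-irrefl refl (subst (r ℕ.<_) e (ℕP.≤-trans (ℕP.n<1+n r) (ℕP.n≤1+n _)))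

    prodFin-sgn-unit : ∀ {l} (ρ : Fin l → Sgn) → prodFin (λ i → sgn (ρ i)) ≡ + 1 ⊎ prodFin (λ i → sgn (ρ i)) ≡ - + 1
    prodFin-sgn-unit {zero}  ρ = inj₁ refl
    prodFin-sgn-unit {suc l} ρ with ρ zero | prodFin-sgn-unit (λ i → ρ (suc i))
    ... | pos | inj₁ e rewrite e = inj₁ refl
    ... | pos | inj₂ e rewrite e = inj₂ refl
    ... | neg | inj₁ e rewrite e = inj₂ refl
    ... | neg | inj₂ e rewrite e = inj₁ refl

    prodFin-sgn≡δ : ∀ {l} (ρ : Fin l → Sgn) → prodFin (λ i → sgn (ρ i)) ≡ δ ρ
    prodFin-sgn≡δ ρ with prodFin-sgn-unit ρ
    ... | inj₁ e rewrite e = refl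
    ... | inj₂ e rewrite e = refl

  -- Write rows 0 and ℓ of C as the corresponding rows of the path matrix P plus the wrap-around
  -- entry β. By linearity det C splits into four determinants: det P, two triangular ones each equal
  -- to sign ℓ · β · Π′, and one in which the two wrap entries leave the inner path 1, …, ℓ - 1.
  module _ (k : ℕ) (σ : Fin (suc (suc (suc k))) → Sgn) where
    private
      n : ℕ
      n = suc (suc (suc k))
      ℓ : ℕ
      ℓ = suc (suc k)
      last : Fin n
      last = fromℕ ℓ
      toℕ-last : toℕ last ≡ ℓ
      toℕ-last = toℕ-fromℕ ℓ
      C = cycleMatrix n σ
      P : Matrix n
      P i j = if (suc (toℕ i) ≡ᵇ toℕ j) then sgn (σ i) else (if (suc (toℕ j) ≡ᵇ toℕ i) then sgn (σ j) else + 0)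
      β : ℤ
      β = sgn (σ last)
      isFirst isLast : Fin n → Bool
      isFirst i = toℕ i ≡ᵇ 0
      isLast i = toℕ i ≡ᵇ ℓ
      wrap₀ wrapₗ : Fin n → ℤ
      wrap₀ j = if isLast j then β else + 0
      wrapₗ j = if isFirst j then β else + 0
      rows : (Fin n → ℤ) → (Fin n → ℤ) → Matrix n
      rows x y i j = if isFirst i then x j else (if isLast i then y j else P i j)

      isLast⇒≡ : ∀ i → isLast i ≡ true → i ≡ last
      isLast⇒≡ i e = toℕ-injective (trans (≡ᵇ-true⇒≡ _ _ e) (sym toℕ-last))
      isFirst⇒≡ : ∀ i → isFirst i ≡ true → i ≡ zero
      isFirst⇒≡ zero e = refl
      isLast-last : isLast last ≡ true
      isLast-last = ≡⇒≡ᵇ-true _ _ toℕ-last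
      n≢ᵇ : ∀ (j : Fin n) → (suc (suc (suc k)) ≡ᵇ toℕ j) ≡ false
      n≢ᵇ j = ≢⇒≡ᵇ-false _ _ (λ e → ℕP.<-irrefl refl (subst (_< n) (sym e) (toℕ<n j)))

      C-first : ∀ j → C zero j ≡ P zero j + wrap₀ j
      C-first j with 1 ≡ᵇ toℕ j in e1 | toℕ j ≡ᵇ ℓ in e2
      ... | true | true = ⊥-elim (ℕP.1+n≢0 (sym (ℕP.suc-injective (trans (≡ᵇ-true⇒≡ 1 (toℕ j) e1) (≡ᵇ-true⇒≡ (toℕ j) ℓ e2)))))
      ... | true | false = sym (ℤP.+-identityʳ _)
      ... | false | true = trans (cong (λ t → sgn (σ t)) (isLast⇒≡ j e2)) (sym (ℤP.+-identityˡ _))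
      ... | false | false = refl

      C-last : ∀ j → C last j ≡ P last j + wrapₗ j
      C-last j rewrite toℕ-fromℕ k | ≡⇒≡ᵇ-true k k refl with suc (suc (suc k)) ≡ᵇ toℕ j in ea | toℕ j ≡ᵇ 0 in ez | toℕ j ≡ᵇ suc k in ed
      ... | true | _ | _ = ⊥-elim (false≢true (trans (sym (n≢ᵇ j)) ea))
      ... | false | true | true = ⊥-elim (ℕP.1+n≢0 (trans (sym (≡ᵇ-true⇒≡ (toℕ j) (suc k) ed)) (≡ᵇ-true⇒≡ (toℕ j) 0 ez)))
      ... | false | true | false = sym (ℤP.+-identityˡ _)
      ... | false | false | true = sym (ℤP.+-identityʳ _)
      ... | false | false | false with toℕ j ≡ᵇ suc (suc k)
      ...   | true = refl
      ...   | false = refl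

      C-middle′ : ∀ i → isFirst i ≡ false → isLast i ≡ false → ∀ j → C i j ≡ P i j
      C-middle′ i ez el j with suc (toℕ i) ≡ᵇ toℕ j | suc (toℕ j) ≡ᵇ toℕ i
      ... | true | _ = refl
      ... | false | d rewrite el with d
      ...   | true = refl
      ...   | false with toℕ j ≡ᵇ ℓ
      ...     | true rewrite ez = refl
      ...     | false = refl

      isFirst-≢ : ∀ i → i ≢ zero → isFirst i ≡ false
      isFirst-≢ zero neq = ⊥-elim (neq refl)
      isFirst-≢ (suc i) neq = refl
      isLast-≢ : ∀ i → i ≢ last → isLast i ≡ false
      isLast-≢ i neq = ≢⇒≡ᵇ-false _ _ (λ e → neq (toℕ-injective (trans e (sym toℕ-last))))

      data RowView (x y : Fin n → ℤ) (i j : Fin n) : Set where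
        at-first : i ≡ zero → rows x y i j ≡ x j → RowView x y i j
        at-last : i ≡ last → rows x y i j ≡ y j → RowView x y i j
        in-middle : i ≢ zero → i ≢ last → rows x y i j ≡ P i j → RowView x y i j

      rowView : ∀ x y i j → RowView x y i j
      rowView x y i j with isFirst i in ez | isLast i in el
      ... | true | _ = at-first (isFirst⇒≡ i ez) (h1 ez)
        where
        h1 : isFirst i ≡ true → rows x y i j ≡ x j
        h1 e rewrite e = refl
      ... | false | true = at-last (isLast⇒≡ i el) (h2 ez el)
        where
        h2 : isFirst i ≡ false → isLast i ≡ true → rows x y i j ≡ y j
        h2 e e′ rewrite e | e′ = refl
      ... | false | false = in-middle (λ e → false≢true (trans (sym ez) (cong isFirst e))) (λ e → false≢true (trans (sym el) (trans (cong isLast e) isLast-last))) (h3 ez el)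
        where
        h3 : isFirst i ≡ false → isLast i ≡ false → rows x y i j ≡ P i j
        h3 e e′ rewrite e | e′ = refl

      rows-last : ∀ x y j → rows x y last j ≡ y j
      rows-last x y j rewrite isLast-last = refl

      C-middle : ∀ i → i ≢ zero → i ≢ last → ∀ j → C i j ≡ P i j
      C-middle i n0 nL j = C-middle′ i (isFirst-≢ i n0) (isLast-≢ i nL) j

      rows-offLast : ∀ x y y′ i j → i ≢ last → rows x y i j ≡ rows x y′ i j
      rows-offLast x y y′ i j neq with isFirst i
      ... | true = refl
      ... | false rewrite isLast-≢ i neq = refl

      P-sym : ∀ i j → P i j ≡ P j i
      P-sym i j with suc (toℕ i) ≡ᵇ toℕ j in e1 | suc (toℕ j) ≡ᵇ toℕ i in e2
      ... | true | true = ⊥-elim (ℕP.<-irrefl refl (subst (toℕ i ℕ.<_) (trans (cong suc (≡ᵇ-true⇒≡ _ _ e1)) (≡ᵇ-true⇒≡ _ _ e2)) (ℕP.≤-trans (ℕP.n<1+n _) (ℕP.n≤1+n _))))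
      ... | true | false = refl
      ... | false | true = refl
      ... | false | false = refl

      φ : ℕ → Fin n
      φ = toFin ℓ
      toℕ-φ : ∀ i → i ℕ.< n → toℕ (φ i) ≡ i
      toℕ-φ i lt = toℕ-toFin ℓ i (ℕP.≤-pred lt)
      P-adjacent : ∀ i j → i ℕ.< n → j ℕ.< n → P (φ i) (φ j) ≢ + 0 → (suc i ≡ j) ⊎ (suc j ≡ i)
      P-adjacent i j i< j< neq with suc (toℕ (φ i)) ≡ᵇ toℕ (φ j) in e1 | suc (toℕ (φ j)) ≡ᵇ toℕ (φ i) in e2
      ... | true | _ = inj₁ (trans (cong suc (sym (toℕ-φ i i<))) (trans (≡ᵇ-true⇒≡ _ _ e1) (toℕ-φ j j<)))
      ... | false | true = inj₂ (trans (cong suc (sym (toℕ-φ j j<))) (trans (≡ᵇ-true⇒≡ _ _ e2) (toℕ-φ i i<)))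
      ... | false | false = ⊥-elim (neq refl)
      P-unit : ∀ i → suc i ℕ.< n → P (φ i) (φ (suc i)) * P (φ i) (φ (suc i)) ≡ + 1
      P-unit i lt rewrite ≡⇒≡ᵇ-true (suc (toℕ (φ i))) (toℕ (φ (suc i))) (trans (cong suc (toℕ-φ i (ℕP.<-trans (ℕP.n<1+n i) lt))) (sym (toℕ-φ (suc i) lt))) = sgn-unit (σ (φ i))
      φ-injective : ∀ i j → i ℕ.< n → j ℕ.< n → φ i ≡ φ j → i ≡ j
      φ-injective i j i< j< e = trans (sym (toℕ-φ i i<)) (trans (cong toℕ e) (toℕ-φ j j<))
      module PathP = Path P P-sym φ n P-adjacent P-unit φ-injective

      det-P : det P ≡ pathDet n
      det-P = PathP.det-path n 0 ℕP.≤-refl (λ a → a) (λ a b e → e)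
        (λ a → toℕ a , z≤n , toℕ<n a , toℕ-injective (sym (toℕ-φ (toℕ a) (toℕ<n a))))
        (λ i _ i< → φ i , refl)

      inner : Fin (suc k) → Fin n
      inner r = suc (inject₁ r)
      det-inner : det (λ r c → P (inner r) (inner c)) ≡ pathDet (suc k)
      det-inner = PathP.det-path (suc k) 1 (ℕP.n≤1+n _) inner (λ a b e → inject₁-injective (suc-injective e))
        (λ a → suc (toℕ a) , s≤s z≤n , s≤s (toℕ<n a) ,
             toℕ-injective (trans (cong suc (toℕ-inject₁ a)) (sym (toℕ-φ (suc (toℕ a)) (s≤s (ℕP.<-trans (toℕ<n a) (ℕP.n<1+n _)))))))
        inner-onto
        where
        inner-onto : ∀ i → 1 ℕ.≤ i → i ℕ.< suc (suc k) → Σ (Fin (suc k)) λ a → inner a ≡ φ i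
        inner-onto (suc i) _ (s≤s i<) = toFin k i , toℕ-injective (trans (cong suc (trans (toℕ-inject₁ _) (toℕ-toFin k i (ℕP.≤-pred i<))))
             (sym (toℕ-φ (suc i) (s≤s (ℕP.<-trans i< (ℕP.n<1+n _))))))

      A₁ B₁ A₂ B₂ A₃ B₃ : Matrix n
      A₁ = rows (P zero) (C last)
      B₁ = rows wrap₀ (C last)
      A₂ = rows (P zero) (P last)
      B₂ = rows (P zero) wrapₗ
      A₃ = rows wrap₀ (P last)
      B₃ = rows wrap₀ wrapₗ

      rows-C : ∀ x i → i ≢ zero → ∀ j → rows x (C last) i j ≡ C i j
      rows-C x i neq j with rowView x (C last) i j
      ... | at-first e _ = ⊥-elim (neq e)
      ... | at-last e q = trans q (cong (λ t → C t j) (sym e))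
      ... | in-middle n0 nL q = trans q (sym (C-middle i n0 nL j))

      split-first : det C ≡ det A₁ + det B₁
      split-first = det-rowLinear C A₁ B₁ zero (rows-C (P zero)) (rows-C wrap₀) C-first

      split-last : ∀ x → det (rows x (C last)) ≡ det (rows x (P last)) + det (rows x wrapₗ)
      split-last x = det-rowLinear (rows x (C last)) (rows x (P last)) (rows x wrapₗ) last (λ i neq j → rows-offLast x (P last) (C last) i j neq)
        (λ i neq j → rows-offLast x wrapₗ (C last) i j neq)
        (λ j → trans (rows-last x (C last) j) (trans (C-last j) (sym (cong₂ _+_ (rows-last x (P last) j) (rows-last x wrapₗ j)))))

      det-A₂ : det A₂ ≡ pathDet n
      det-A₂ = trans (det-cong λ i j → A₂≡P i j) det-P
        where
        A₂≡P : ∀ i j → A₂ i j ≡ P i j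
        A₂≡P i j with rowView (P zero) (P last) i j
        ... | at-first e q = trans q (cong (λ t → P t j) (sym e))
        ... | at-last e q = trans q (cong (λ t → P t j) (sym e))
        ... | in-middle _ _ q = q

      Π′ : ℤ
      Π′ = prodFin (λ r → sgn (σ (inject₁ {n = ℓ} r)))

      inject₁≢last : ∀ (r : Fin ℓ) → inject₁ r ≢ last
      inject₁≢last r e = ℕP.<-irrefl refl (subst (ℕ._< ℓ) (trans (sym (toℕ-inject₁ r)) (trans (cong toℕ e) toℕ-last)) (toℕ<n r))

      det-B₂ : det B₂ ≡ sign ℓ * β * Π′
      det-B₂ = trans (det-rowSingleton B₂ last zero row-zero)
         (trans (cong₂ (λ x y → sign x * sign 0 * y * det (λ r c → B₂ (punchIn last r) (punchIn zero c))) toℕ-last (rows-last (P zero) wrapₗ zero))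
         (trans (cong (λ t → sign ℓ * + 1 * β * t) (trans (det-cong minor≡) (trans (det-lowerTriangular _ above-zero) (prodFin-cong diagonal))))
           (unit-factor (sign ℓ) β Π′)))
        where
        row-zero : ∀ j → j ≢ zero → B₂ last j ≡ + 0
        row-zero j neq rewrite rows-last (P zero) wrapₗ j | isFirst-≢ j neq = refl
        minor≡ : ∀ r c → B₂ (punchIn last r) (punchIn zero c) ≡ P (inject₁ r) (suc c)
        minor≡ r c rewrite punchIn-last r with rowView (P zero) wrapₗ (inject₁ r) (suc c)
        ... | at-first e q = trans q (cong (λ t → P t (suc c)) (sym e))
        ... | at-last e q = ⊥-elim (inject₁≢last r e)
        ... | in-middle _ _ q = q
        above-zero : ∀ r c → toℕ r ℕ.< toℕ c → P (inject₁ r) (suc c) ≡ + 0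
        above-zero r c lt rewrite toℕ-inject₁ r | ≢⇒≡ᵇ-false (toℕ r) (toℕ c) (λ e → ℕP.<-irrefl e lt)
          | ≢⇒≡ᵇ-false (suc (suc (toℕ c))) (toℕ r) (2+c≢r lt) = refl
        diagonal : ∀ r → P (inject₁ r) (suc r) ≡ sgn (σ (inject₁ r))
        diagonal r rewrite toℕ-inject₁ r | ≡⇒≡ᵇ-true (toℕ r) (toℕ r) refl = refl
        unit-factor : ∀ a β p → a * + 1 * β * p ≡ a * β * p
        unit-factor = solve-∀

      det-A₃ : det A₃ ≡ sign ℓ * β * Π′
      det-A₃ = trans (det-rowSingleton A₃ zero last row-zero)
         (trans (cong₂ (λ x y → sign 0 * sign x * y * det (λ r c → A₃ (punchIn zero r) (punchIn last c))) toℕ-last entry-β)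
         (trans (cong (λ t → + 1 * sign ℓ * β * t) (trans (det-cong minor≡) (trans (det-upperTriangular _ below-zero) (prodFin-cong diagonal))))
           (unit-factor (sign ℓ) β Π′)))
        where
        row-zero : ∀ j → j ≢ last → A₃ zero j ≡ + 0
        row-zero j neq rewrite isLast-≢ j neq = refl
        entry-β : A₃ zero last ≡ β
        entry-β rewrite isLast-last = refl
        minor≡ : ∀ r c → A₃ (punchIn zero r) (punchIn last c) ≡ P (suc r) (inject₁ c)
        minor≡ r c rewrite punchIn-last c with rowView wrap₀ (P last) (suc r) (inject₁ c)
        ... | at-first () q
        ... | at-last e q = trans q (cong (λ t → P t (inject₁ c)) (sym e))
        ... | in-middle _ _ q = q
        below-zero : ∀ r c → toℕ c ℕ.< toℕ r → P (suc r) (inject₁ c) ≡ + 0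
        below-zero r c lt rewrite toℕ-inject₁ c | ≢⇒≡ᵇ-false (suc (suc (toℕ r))) (toℕ c) (2+c≢r lt)
          | ≢⇒≡ᵇ-false (toℕ c) (toℕ r) (λ e → ℕP.<-irrefl e lt) = refl
        diagonal : ∀ r → P (suc r) (inject₁ r) ≡ sgn (σ (inject₁ r))
        diagonal r rewrite toℕ-inject₁ r | ≢⇒≡ᵇ-false (suc (suc (toℕ r))) (toℕ r) (2+r≢r (toℕ r)) | ≡⇒≡ᵇ-true (toℕ r) (toℕ r) refl = refl
        unit-factor : ∀ a β p → + 1 * a * β * p ≡ a * β * p
        unit-factor = solve-∀

      last′ : Fin ℓ
      last′ = fromℕ (suc k)

      inner≢last : ∀ r → inner r ≢ last
      inner≢last r e = ℕP.<-irrefl refl (subst (ℕ._< ℓ) (trans (cong suc (sym (toℕ-inject₁ r))) (trans (cong toℕ e) toℕ-last)) (s≤s (toℕ<n r)))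

      det-B₃ : det B₃ ≡ - pathDet (suc k)
      det-B₃ = trans (det-rowSingleton B₃ zero last row-zero)
         (trans (cong₂ (λ x y → sign 0 * sign x * y * det N) toℕ-last entry-β)
         (trans (cong (λ t → + 1 * sign ℓ * β * t) det-N)
         (trans (cong (λ x → + 1 * x * β * (sign (suc k) * β * pathDet (suc k))) (sign-suc (suc k)))
         (unit-factor (sign (suc k)) β (pathDet (suc k)) (sgn-unit (σ last)) (sign-sq (suc k))))))
        where
        row-zero : ∀ j → j ≢ last → B₃ zero j ≡ + 0
        row-zero j neq rewrite isLast-≢ j neq = refl
        entry-β : B₃ zero last ≡ β
        entry-β rewrite isLast-last = refl
        N : Matrix ℓ
        N r c = B₃ (punchIn zero r) (punchIn last c)
        row-zero′ : ∀ j → j ≢ zero → N last′ j ≡ + 0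
        row-zero′ zero neq = ⊥-elim (neq refl)
        row-zero′ (suc j) neq rewrite rows-last wrap₀ wrapₗ (punchIn last (suc j)) = refl
        entry-β′ : N last′ zero ≡ β
        entry-β′ = rows-last wrap₀ wrapₗ zero
        minor≡ : ∀ r c → N (punchIn last′ r) (punchIn zero c) ≡ P (inner r) (inner c)
        minor≡ r c rewrite punchIn-last r | punchIn-last c with rowView wrap₀ wrapₗ (inner r) (inner c)
        ... | at-first () q
        ... | at-last e q = ⊥-elim (inner≢last r e)
        ... | in-middle _ _ q = q
        det-N : det N ≡ sign (suc k) * β * pathDet (suc k)
        det-N = trans (det-rowSingleton N last′ zero row-zero′) (trans (cong₂ (λ x y → sign x * sign 0 * y * det (λ r c → N (punchIn last′ r) (punchIn zero c))) (toℕ-fromℕ (suc k)) entry-β′)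
          (trans (cong (λ t → sign (suc k) * + 1 * β * t) (trans (det-cong minor≡) det-inner)) (unit-factor′ (sign (suc k)) β (pathDet (suc k)))))
          where
          unit-factor′ : ∀ a β p → a * + 1 * β * p ≡ a * β * p
          unit-factor′ = solve-∀
        unit-factor : ∀ s β p → β * β ≡ + 1 → s * s ≡ + 1 → + 1 * (- s) * β * (s * β * p) ≡ - p
        unit-factor s β p bb ss = trans (regroup s β p) (trans (cong (λ x → - (x * (β * β) * p)) ss) (trans (cong (λ x → - (+ 1 * x * p)) bb) (unit-factor′′ p)))
          where
          regroup : ∀ s β p → + 1 * (- s) * β * (s * β * p) ≡ - ((s * s) * (β * β) * p)
          regroup = solve-∀
          unit-factor′′ : ∀ p → - (+ 1 * + 1 * p) ≡ - p
          unit-factor′′ = solve-∀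

    det-cycle : det (cycleMatrix (suc (suc (suc k))) σ)
              ≡ pathDet (suc (suc (suc k))) + - pathDet (suc k) + + 2 * (sign (suc (suc k)) * δ σ)
    det-cycle = trans split-first (trans (cong₂ _+_ (split-last (P zero)) (split-last wrap₀))
      (trans (cong₂ _+_ (cong₂ _+_ det-A₂ det-B₂) (cong₂ _+_ det-A₃ det-B₃))
        (trans (collect (pathDet n) (pathDet (suc k)) (sign ℓ) β Π′)
          (cong (λ t → pathDet n + - pathDet (suc k) + + 2 * (sign ℓ * t)) (trans (sym (prodFin-snoc (λ i → sgn (σ i)))) (prodFin-sgn≡δ σ))))))
      where
      collect : ∀ a c s β p → a + s * β * p + (s * β * p + - c) ≡ a + - c + + 2 * (s * (p * β))
      collect = solve-∀

    det-cycle-even : ∀ q → suc k ≡ q ℕ.+ q → det (cycleMatrix (suc (suc (suc k))) σ) ≡ - (+ 2 * δ σ) + + 2 * sign (suc q)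
    det-cycle-even q e = trans det-cycle (trans
      (cong₂ (λ x y → - x + - x + + 2 * (y * δ σ)) (trans (cong pathDet e) (pathDet-even q)) odd-sign)
      (trans (collect (sign q) (δ σ)) (cong (λ t → - (+ 2 * δ σ) + + 2 * t) (sym (sign-suc q)))))
      where
      odd-sign : sign (suc (suc k)) ≡ - + 1
      odd-sign = trans (cong (sign ∘ suc) e) (trans (sign-suc (q ℕ.+ q)) (cong -_ (sign-double q)))
      collect : ∀ s d → - s + - s + + 2 * (- + 1 * d) ≡ - (+ 2 * d) + + 2 * (- s)
      collect = solve-∀

    det-cycle-odd : ∀ q → suc k ≡ suc (q ℕ.+ q) → det (cycleMatrix (suc (suc (suc k))) σ) ≡ + 2 * δ σ
    det-cycle-odd q e = trans det-cycle (trans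
      (cong₂ (λ x y → - x + - x + + 2 * (y * δ σ)) (trans (cong pathDet e) (pathDet-odd q)) even-sign)
      (collect (δ σ)))
      where
      even-sign : sign (suc (suc k)) ≡ + 1
      even-sign = trans (cong (sign ∘ suc) e) (trans (sign-suc (suc (q ℕ.+ q)))
                    (trans (cong -_ (sign-suc (q ℕ.+ q))) (trans (ℤP.neg-involutive _) (sign-double q))))
      collect : ∀ d → - + 0 + - + 0 + + 2 * (+ 1 * d) ≡ + 2 * d
      collect = solve-∀


module Unicyclic where

  open Determinant
  open SignedPath
  open Matchings
  open Trees using (tree-hasInducedLeaves)
  open Cycle
  open import Data.Nat as ℕ using (ℕ; zero; suc; _≤_; _<_; z≤n; s≤s)
  import Data.Nat.Properties as ℕP
  open import Data.Integer using (+_; -_; _*_)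
  open import Data.Integer.Properties using (*-identityˡ) renaming (_≟_ to _≟ℤ_)
  open import Data.Integer.Tactic.RingSolver using (solve-∀)
  open import Data.Fin using (Fin; zero; suc; cast; splitAt; _↑ˡ_; _↑ʳ_; _≟_)
  open import Data.Fin.Properties
    using (cast-is-id; ↑ʳ-injective; ↑ˡ-injective; any?; suc-injective;
           splitAt-↑ˡ; splitAt-↑ʳ; splitAt⁻¹-↑ˡ; splitAt⁻¹-↑ʳ)
  open import Data.Product using (Σ; _,_; proj₁; proj₂; _×_)
  open import Data.Sum using (_⊎_; inj₁; inj₂)
  open import Relation.Binary.PropositionalEquality
  open import Relation.Nullary using (¬_; yes; no)
  open import Relation.Nullary.Decidable using (¬?)
  open import Data.Empty using (⊥-elim)
  open import Function using (_∘_)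

  ↑ˡ-or-↑ʳ : ∀ n m (i : Fin (n ℕ.+ m)) → (Σ (Fin n) λ c → c ↑ˡ m ≡ i) ⊎ (Σ (Fin m) λ a → n ↑ʳ a ≡ i)
  ↑ˡ-or-↑ʳ n m i with splitAt n i in e
  ... | inj₁ c = inj₁ (c , splitAt⁻¹-↑ˡ e)
  ... | inj₂ a = inj₂ (a , splitAt⁻¹-↑ʳ e)

  ↑ˡ≢↑ʳ : ∀ {n k} (c : Fin n) (a : Fin k) → c ↑ˡ k ≢ n ↑ʳ a
  ↑ˡ≢↑ʳ {n} {k} c a e with () ← trans (sym (splitAt-↑ˡ n c k)) (trans (cong (splitAt n) e) (splitAt-↑ʳ n k a))

  mapRight : ∀ n {k m} → (Fin k → Fin m) → Fin (n ℕ.+ k) → Fin (n ℕ.+ m)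
  mapRight zero    f i       = f i
  mapRight (suc n) f zero    = zero
  mapRight (suc n) f (suc i) = suc (mapRight n f i)

  mapRight-↑ˡ : ∀ n {k m} (f : Fin k → Fin m) (c : Fin n) → mapRight n f (c ↑ˡ k) ≡ c ↑ˡ m
  mapRight-↑ˡ (suc n) f zero    = refl
  mapRight-↑ˡ (suc n) f (suc c) = cong suc (mapRight-↑ˡ n f c)

  mapRight-↑ʳ : ∀ n {k m} (f : Fin k → Fin m) (a : Fin k) → mapRight n f (n ↑ʳ a) ≡ n ↑ʳ f a
  mapRight-↑ʳ zero    f a = refl
  mapRight-↑ʳ (suc n) f a = cong suc (mapRight-↑ʳ n f a)

  mapRight-id : ∀ n {m} (i : Fin (n ℕ.+ m)) → mapRight n (λ a → a) i ≡ i
  mapRight-id zero    i       = refl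
  mapRight-id (suc n) zero    = refl
  mapRight-id (suc n) (suc i) = cong suc (mapRight-id n i)

  mapRight-empty : ∀ n {m} (f : Fin 0 → Fin m) .(e : n ≡ n ℕ.+ 0) (i : Fin n) → mapRight n f (cast e i) ≡ i ↑ˡ m
  mapRight-empty (suc n) f e zero    = refl
  mapRight-empty (suc n) f e (suc i) = cong suc (mapRight-empty n f _ i)

  punchIn₂ʳ : ∀ n {k} → Fin (suc (suc k)) → Fin (suc (suc k)) → Fin (n ℕ.+ k) → Fin (n ℕ.+ suc (suc k))
  punchIn₂ʳ zero    a b x       = punchIn₂ a b x
  punchIn₂ʳ (suc n) a b zero    = zero
  punchIn₂ʳ (suc n) a b (suc x) = suc (punchIn₂ʳ n a b x)

  mapRight-punchIn₂ʳ : ∀ n {k m} (f : Fin (suc (suc k)) → Fin m) a b x →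
    mapRight n f (punchIn₂ʳ n a b x) ≡ mapRight n (f ∘ punchIn₂ a b) x
  mapRight-punchIn₂ʳ zero    f a b x       = refl
  mapRight-punchIn₂ʳ (suc n) f a b zero    = refl
  mapRight-punchIn₂ʳ (suc n) f a b (suc x) = cong suc (mapRight-punchIn₂ʳ n f a b x)

  private
    cast-punchIn₂-↑ʳ : ∀ n {k} (a b : Fin (suc (suc k))) (x : Fin (n ℕ.+ k))
      .(E : suc (suc (n ℕ.+ k)) ≡ n ℕ.+ suc (suc k)) .(E′ : n ℕ.+ suc (suc k) ≡ suc (suc (n ℕ.+ k))) →
      cast E (punchIn₂ (cast E′ (n ↑ʳ a)) (cast E′ (n ↑ʳ b)) x) ≡ punchIn₂ʳ n a b x
    cast-punchIn₂-↑ʳ zero    a b x E E′ rewrite cast-is-id E′ a | cast-is-id E′ b = cast-is-id E _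
    cast-punchIn₂-↑ʳ (suc n) a b zero    E E′ = refl
    cast-punchIn₂-↑ʳ (suc n) a b (suc x) E E′ = cong suc (cast-punchIn₂-↑ʳ n a b x _ _)

  det-pendantʳ : ∀ n {k} (M : Matrix (n ℕ.+ suc (suc k))) → (∀ i j → M i j ≡ M j i) →
    (a b : Fin (suc (suc k))) → a ≢ b → (∀ x → x ≢ n ↑ʳ b → M (n ↑ʳ a) x ≡ + 0) →
    M (n ↑ʳ a) (n ↑ʳ b) * M (n ↑ʳ a) (n ↑ʳ b) ≡ + 1 →
    det M ≡ - det (λ i j → M (punchIn₂ʳ n a b i) (punchIn₂ʳ n a b j))
  det-pendantʳ n {k} M M-sym a b a≢b row-a unit-ab =
    trans (det-pendantᶜ M M-sym (λ e → a≢b (↑ʳ-injective n a b e)) row-a unit-ab)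
          (cong -_ (det-cong (λ i j → cong₂ M (cast-punchIn₂-↑ʳ n a b i E (sym E)) (cast-punchIn₂-↑ʳ n a b j E (sym E)))))
    where
    E : suc (suc (n ℕ.+ k)) ≡ n ℕ.+ suc (suc k)
    E = sym (trans (ℕP.+-suc n (suc k)) (cong suc (ℕP.+-suc n k)))
    open Cast₂ E (n ↑ʳ a) (n ↑ʳ b)

  linkEntry-≢r : ∀ {n m} (v : Fin n) (r : Fin m) τ c b → b ≢ r → linkEntry v r τ c b ≡ + 0
  linkEntry-≢r v r τ c b b≢r with c ≟ v | b ≟ r
  ... | yes _ | yes e = ⊥-elim (b≢r e)
  ... | yes _ | no _  = refl
  ... | no _  | _     = refl

  linkEntry-≢v : ∀ {n m} (v : Fin n) (r : Fin m) τ c b → c ≢ v → linkEntry v r τ c b ≡ + 0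
  linkEntry-≢v v r τ c b c≢v with c ≟ v
  ... | yes e = ⊥-elim (c≢v e)
  ... | no _  = refl

  linkEntry-vr : ∀ {n m} (v : Fin n) (r : Fin m) τ → linkEntry v r τ v r ≡ sgn τ
  linkEntry-vr v r τ with v ≟ v | r ≟ r
  ... | yes _   | yes _   = refl
  ... | no v≢v  | _       = ⊥-elim (v≢v refl)
  ... | yes _   | no r≢r  = ⊥-elim (r≢r refl)

  module Reduction (n₁ : ℕ) (2≤n₁ : 2 ≤ n₁) (σ : Fin (suc n₁) → Sgn) (v : Fin (suc n₁))
    (m : ℕ) (T : Matrix m) (SG : IsSignedGraph T) (TR : IsTree T) (r : Fin m) (τ : Sgn) where

    open IsSignedGraph SG

    N : ℕ
    N = suc n₁

    C : Matrix N
    C = cycleMatrix N σ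

    U : Matrix (N ℕ.+ m)
    U = unicyclic N σ v m T r τ

    private
      3≤N : 3 ≤ N
      3≤N = s≤s 2≤n₁

      U-cc : ∀ c d → U (c ↑ˡ m) (d ↑ˡ m) ≡ C c d
      U-cc c d rewrite splitAt-↑ˡ N c m | splitAt-↑ˡ N d m = refl
      U-tt : ∀ a b → U (N ↑ʳ a) (N ↑ʳ b) ≡ T a b
      U-tt a b rewrite splitAt-↑ʳ N m a | splitAt-↑ʳ N m b = refl
      U-ct : ∀ c b → U (c ↑ˡ m) (N ↑ʳ b) ≡ linkEntry v r τ c b
      U-ct c b rewrite splitAt-↑ˡ N c m | splitAt-↑ʳ N m b = refl
      U-tc : ∀ a d → U (N ↑ʳ a) (d ↑ˡ m) ≡ linkEntry v r τ d a
      U-tc a d rewrite splitAt-↑ʳ N m a | splitAt-↑ˡ N d m = refl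

      T-unit : ∀ a b → T a b ≢ + 0 → T a b * T a b ≡ + 1
      T-unit a b ne with entries a b
      ... | inj₁ e        = ⊥-elim (ne e)
      ... | inj₂ (inj₁ e) rewrite e = refl
      ... | inj₂ (inj₂ e) rewrite e = refl

    U-sym : ∀ i j → U i j ≡ U j i
    U-sym i j with ↑ˡ-or-↑ʳ N m i | ↑ˡ-or-↑ʳ N m j
    ... | inj₁ (c , refl) | inj₁ (d , refl) = trans (U-cc c d) (trans (cycleMatrix-sym σ 3≤N c d) (sym (U-cc d c)))
    ... | inj₁ (c , refl) | inj₂ (b , refl) = trans (U-ct c b) (sym (U-tc b c))
    ... | inj₂ (a , refl) | inj₁ (d , refl) = trans (U-tc a d) (sym (U-ct d a))
    ... | inj₂ (a , refl) | inj₂ (b , refl) = trans (U-tt a b) (trans (symmetric a b) (sym (U-tt b a)))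

    -- C_n with v deleted is the path walk 0, …, walk (n₁ - 1).
    det-cycle∖v : (g : Fin n₁ → Fin (N ℕ.+ m)) → (∀ a b → g a ≡ g b → a ≡ b) →
      (∀ x → Σ (Fin N) λ c → c ≢ v × g x ≡ c ↑ˡ m) → (∀ c → c ≢ v → Σ (Fin n₁) λ x → g x ≡ c ↑ˡ m) →
      det (induced U g) ≡ pathDet n₁
    det-cycle∖v g g-injective g-into g-onto = WalkPath.det-path n₁ 0 ℕP.≤-refl g g-injective into onto
      where
      open WalkFrom n₁ 2≤n₁ v
      φ : ℕ → Fin (N ℕ.+ m)
      φ i = walk i ↑ˡ m
      φ-adjacent : ∀ i j → i < n₁ → j < n₁ → U (φ i) (φ j) ≢ + 0 → suc i ≡ j ⊎ suc j ≡ i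
      φ-adjacent i j i< j< ne with cycleMatrix-support σ (walk i) (walk j) (λ e → ne (trans (U-cc (walk i) (walk j)) e))
      ... | inj₁ e = inj₁ (walk-next⇒suc i j i< j< e)
      ... | inj₂ e = inj₂ (walk-next⇒suc j i j< i< e)
      φ-unit : ∀ i → suc i < n₁ → U (φ i) (φ (suc i)) * U (φ i) (φ (suc i)) ≡ + 1
      φ-unit i _ rewrite U-cc (walk i) (walk (suc i)) = cycleMatrix-unit σ (walk i) (walk (suc i))
        (λ e → sgn≢0 (σ (walk i)) (trans (sym (cycleMatrix-next σ (walk i) (walk (suc i)) (walk-next i))) e))
      φ-injective : ∀ i j → i < n₁ → j < n₁ → φ i ≡ φ j → i ≡ j
      φ-injective i j i< j< e = walk-injective i j i< j< (↑ˡ-injective m (walk i) (walk j) e)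
      module WalkPath = Path U U-sym φ n₁ φ-adjacent φ-unit φ-injective
      into : ∀ a → Σ ℕ λ i → 0 ≤ i × i < 0 ℕ.+ n₁ × g a ≡ φ i
      into a with g-into a
      ... | c , c≢v , e with walk-surjective c c≢v
      ...   | i , i< , walk-i = i , z≤n , i< , trans e (cong (_↑ˡ m) (sym walk-i))
      onto : ∀ i → 0 ≤ i → i < 0 ℕ.+ n₁ → Σ (Fin n₁) λ a → g a ≡ φ i
      onto i _ i< = g-onto (walk i) (walk≢v i i<)

    Sub : ∀ {k} → (Fin k → Fin m) → Matrix (N ℕ.+ k)
    Sub f = induced U (mapRight N f)

    withV : ∀ {k} → (Fin k → Fin m) → Fin (suc k) → Fin (N ℕ.+ m)
    withV f zero    = v ↑ˡ m
    withV f (suc b) = N ↑ʳ f b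

    data Outcome {k} (f : Fin k → Fin m) : Set where
      treeMatched : PerfectMatching (induced T f) → ¬ PerfectMatching (induced U (withV f)) →
        (p : ℕ) → k ≡ p ℕ.+ p → det (Sub f) ≡ sign p * det C → Outcome f
      vMatched : ¬ PerfectMatching (induced T f) → PerfectMatching (induced U (withV f)) →
        (p : ℕ) → k ≡ suc (p ℕ.+ p) → det (Sub f) ≡ sign (suc p) * pathDet n₁ → Outcome f
      unmatched : ¬ PerfectMatching (induced T f) → ¬ PerfectMatching (induced U (withV f)) →
        det (Sub f) ≡ + 0 → Outcome f

    private
      Sub-tc : ∀ {k} (f : Fin k → Fin m) a c → Sub f (N ↑ʳ a) (c ↑ˡ k) ≡ linkEntry v r τ c (f a)
      Sub-tc f a c = trans (cong₂ U (mapRight-↑ʳ N f a) (mapRight-↑ˡ N f c)) (U-tc (f a) c)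

      Sub-tt : ∀ {k} (f : Fin k → Fin m) a b → Sub f (N ↑ʳ a) (N ↑ʳ b) ≡ T (f a) (f b)
      Sub-tt f a b = trans (cong₂ U (mapRight-↑ʳ N f a) (mapRight-↑ʳ N f b)) (U-tt (f a) (f b))

      Sub-row : ∀ {k} (f : Fin k → Fin m) a → f a ≢ r → ∀ x →
        (∀ b → N ↑ʳ b ≡ x → T (f a) (f b) ≡ + 0) → Sub f (N ↑ʳ a) x ≡ + 0
      Sub-row {k} f a fa≢r x tree-row with ↑ˡ-or-↑ʳ N k x
      ... | inj₁ (c , refl) = trans (Sub-tc f a c) (linkEntry-≢r v r τ c (f a) fa≢r)
      ... | inj₂ (b , refl) = trans (Sub-tt f a b) (tree-row b refl)

      T-adj-sym : ∀ {k} (f : Fin k → Fin m) i j → Adj (induced T f) i j → Adj (induced T f) j i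
      T-adj-sym f i j a e = a (trans (symmetric _ _) e)

      U-adj-sym : ∀ {k} (g : Fin k → Fin (N ℕ.+ m)) i j → Adj (induced U g) i j → Adj (induced U g) j i
      U-adj-sym g i j a e = a (trans (U-sym (g i) (g j)) e)

      det-Sub-empty : (f : Fin 0 → Fin m) → det (Sub f) ≡ det C
      det-Sub-empty f = trans (sym (det-cast e (Sub f)))
        (det-cong λ i j → trans (cong₂ U (mapRight-empty N f e i) (mapRight-empty N f e j)) (U-cc i j))
        where
        e : N ≡ N ℕ.+ 0
        e = sym (ℕP.+-identityʳ N)

      -- With only the root r left, r is pendant at v, and deleting r and v leaves C_n ∖ v.
      det-Sub-root : (f : Fin 1 → Fin m) → f zero ≡ r → det (Sub f) ≡ sign 1 * pathDet n₁
      det-Sub-root f f0≡r =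
        trans (det-pendantᶜ (Sub f) (λ i j → U-sym (mapRight N f i) (mapRight N f j)) u≢w row-u unit-uw)
              (trans (cong -_ (det-cycle∖v g g-injective g-into g-onto)) (neg-sign1 (pathDet n₁)))
        where
        E : suc (suc n₁) ≡ N ℕ.+ 1
        E = cong suc (ℕP.+-comm 1 n₁)
        u w : Fin (N ℕ.+ 1)
        u = N ↑ʳ zero
        w = v ↑ˡ 1
        open Cast₂ E u w
        neg-sign1 : ∀ x → - x ≡ sign 1 * x
        neg-sign1 = solve-∀
        u≢w : u ≢ w
        u≢w e = ↑ˡ≢↑ʳ v zero (sym e)
        row-u : ∀ j → j ≢ w → Sub f u j ≡ + 0
        row-u j j≢w with ↑ˡ-or-↑ʳ N 1 j
        ... | inj₁ (c , refl) = trans (Sub-tc f zero c) (linkEntry-≢v v r τ c (f zero) (λ e → j≢w (cong (_↑ˡ 1) e)))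
        ... | inj₂ (zero , refl) = trans (Sub-tt f zero zero) (loopless (f zero))
        unit-uw : Sub f u w * Sub f u w ≡ + 1
        unit-uw rewrite Sub-tc f zero v | f0≡r | linkEntry-vr v r τ = sgn-unit τ
        onCycle : ∀ x → Σ (Fin N) λ c → c ≢ v × punchIn₂ᶜ x ≡ c ↑ˡ 1
        onCycle x with ↑ˡ-or-↑ʳ N 1 (punchIn₂ᶜ x)
        ... | inj₁ (c , e)    = c , (λ c≡v → punchIn₂ᶜ≢ʳ u≢w x (trans (sym e) (cong (_↑ˡ 1) c≡v))) , sym e
        ... | inj₂ (zero , e) = ⊥-elim (punchIn₂ᶜ≢ˡ x (sym e))
        cycleOf : Fin n₁ → Fin N
        cycleOf x = proj₁ (onCycle x)
        g : Fin n₁ → Fin (N ℕ.+ m)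
        g x = mapRight N f (punchIn₂ᶜ x)
        g≡cycleOf : ∀ x → g x ≡ cycleOf x ↑ˡ m
        g≡cycleOf x = trans (cong (mapRight N f) (proj₂ (proj₂ (onCycle x)))) (mapRight-↑ˡ N f (cycleOf x))
        g-into : ∀ x → Σ (Fin N) λ c → c ≢ v × g x ≡ c ↑ˡ m
        g-into x = cycleOf x , proj₁ (proj₂ (onCycle x)) , g≡cycleOf x
        g-injective : ∀ a b → g a ≡ g b → a ≡ b
        g-injective a b e = punchIn₂ᶜ-injective a b (trans (proj₂ (proj₂ (onCycle a)))
          (trans (cong (_↑ˡ 1) (↑ˡ-injective m _ _ (trans (sym (g≡cycleOf a)) (trans e (g≡cycleOf b)))))
                 (sym (proj₂ (proj₂ (onCycle b))))))
        g-onto : ∀ c → c ≢ v → Σ (Fin n₁) λ x → g x ≡ c ↑ˡ m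
        g-onto c c≢v with punchIn₂ᶜ-surjective u≢w (c ↑ˡ 1) (↑ˡ≢↑ʳ c zero) (λ e → c≢v (↑ˡ-injective 1 c v e))
        ... | x , e = x , trans (cong (mapRight N f) e) (mapRight-↑ˡ N f c)

      -- A tree vertex a ≠ r with no neighbour in f is isolated in all three graphs.
      outcome-isolated : ∀ {k} (f : Fin k → Fin m) a → f a ≢ r → (∀ b → T (f a) (f b) ≡ + 0) → Outcome f
      outcome-isolated f a fa≢r no-edge =
        unmatched (isolated⇒noPerfectMatching _ a (λ j adj → adj (no-edge j)))
                  (isolated⇒noPerfectMatching _ (suc a) isolated)
                  (det-zeroRow (Sub f) (N ↑ʳ a) (λ x → Sub-row f a fa≢r x (λ b _ → no-edge b)))
        where
        isolated : ∀ j → ¬ Adj (induced U (withV f)) (suc a) j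
        isolated zero    adj = adj (trans (U-tc (f a) v) (linkEntry-≢r v r τ v (f a) fa≢r))
        isolated (suc j) adj = adj (trans (U-tt (f a) (f j)) (no-edge j))

      -- A pendant edge ab of the tree part with a ≠ r stays pendant in all three graphs;
      -- deleting a and b flips the sign of the determinant and preserves perfect matchings.
      outcome-pendant : ∀ {k} (f : Fin (suc (suc k)) → Fin m) a b → f a ≢ r →
        Adj (induced T f) a b → (∀ j → Adj (induced T f) a j → j ≡ b) →
        Outcome (f ∘ punchIn₂ a b) → Outcome f
      outcome-pendant {k} f a b fa≢r ab pendant = lift
        where
        a≢b : a ≢ b
        a≢b e = ab (trans (cong (λ t → T (f a) (f t)) (sym e)) (loopless (f a)))
        module Tree = PendantEdge (induced T f) (T-adj-sym f) a b a≢b ab pendant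
        pendantV : ∀ j → Adj (induced U (withV f)) (suc a) j → j ≡ suc b
        pendantV zero    adj = ⊥-elim (adj (trans (U-tc (f a) v) (linkEntry-≢r v r τ v (f a) fa≢r)))
        pendantV (suc j) adj = cong suc (pendant j (λ e → adj (trans (U-tt (f a) (f j)) e)))
        module WithV = PendantEdge (induced U (withV f)) (U-adj-sym (withV f)) (suc a) (suc b)
          (λ e → a≢b (suc-injective e)) (λ e → ab (trans (sym (U-tt (f a) (f b))) e)) pendantV
        V-minor : ∀ i j → WithV.M′ i j ≡ induced U (withV (f ∘ punchIn₂ a b)) i j
        V-minor zero    zero    = refl
        V-minor zero    (suc j) = refl
        V-minor (suc i) zero    = refl
        V-minor (suc i) (suc j) = refl
        row-a : ∀ x → x ≢ N ↑ʳ b → Sub f (N ↑ʳ a) x ≡ + 0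
        row-a x x≢b = Sub-row f a fa≢r x λ b′ e → no-edge b′ (λ q → x≢b (trans (sym e) (cong (N ↑ʳ_) q)))
          where
          no-edge : ∀ b′ → b′ ≢ b → T (f a) (f b′) ≡ + 0
          no-edge b′ b′≢b with T (f a) (f b′) ≟ℤ + 0
          ... | yes e  = e
          ... | no adj = ⊥-elim (b′≢b (pendant b′ adj))
        unit-ab : Sub f (N ↑ʳ a) (N ↑ʳ b) * Sub f (N ↑ʳ a) (N ↑ʳ b) ≡ + 1
        unit-ab rewrite Sub-tt f a b = T-unit (f a) (f b) ab
        det-step : det (Sub f) ≡ - det (Sub (f ∘ punchIn₂ a b))
        det-step = trans (det-pendantʳ N (Sub f) (λ i j → U-sym (mapRight N f i) (mapRight N f j)) a b a≢b row-a unit-ab)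
          (cong -_ (det-cong λ i j → cong₂ U (mapRight-punchIn₂ʳ N f a b i) (mapRight-punchIn₂ʳ N f a b j)))
        neg-sign : ∀ p x → - (sign p * x) ≡ sign (suc p) * x
        neg-sign p x rewrite sign-suc p = neg-* (sign p) x
          where
          neg-* : ∀ a x → - (a * x) ≡ (- a) * x
          neg-* = solve-∀
        lift : Outcome (f ∘ punchIn₂ a b) → Outcome f
        lift (treeMatched pm ¬pmV p k≡2p d) =
          treeMatched (Tree.extend pm) (λ P → ¬pmV (perfectMatching-cong V-minor (WithV.restrict P)))
            (suc p) (cong suc (trans (cong suc k≡2p) (sym (ℕP.+-suc p p)))) (trans det-step (trans (cong -_ d) (neg-sign p (det C))))
        lift (vMatched ¬pm pmV p k≡2p+1 d) =
          vMatched (λ P → ¬pm (Tree.restrict P)) (WithV.extend (perfectMatching-cong (λ i j → sym (V-minor i j)) pmV))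
            (suc p) (cong suc (cong suc (trans k≡2p+1 (sym (ℕP.+-suc p p))))) (trans det-step (trans (cong -_ d) (neg-sign (suc p) (pathDet n₁))))
        lift (unmatched ¬pm ¬pmV d) =
          unmatched (λ P → ¬pm (Tree.restrict P)) (λ P → ¬pmV (perfectMatching-cong V-minor (WithV.restrict P)))
            (trans det-step (cong -_ d))

    -- Repeatedly delete a pendant edge of the tree part avoiding the root; what remains is
    -- nothing, the root alone (then pendant at v), or an isolated vertex.
    outcome : ∀ k (f : Fin k → Fin m) → (∀ a b → f a ≡ f b → a ≡ b) → Outcome f
    outcome zero f _ = treeMatched (perfectMatching-zero _) (noPerfectMatching-one _) 0 refl
      (trans (det-Sub-empty f) (sym (*-identityˡ (det C))))
    outcome (suc zero) f _ with f zero ≟ r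
    ... | yes f0≡r = vMatched (noPerfectMatching-one _) (perfectMatching-two _ vr (U-adj-sym (withV f) zero (suc zero) vr))
                       0 refl (det-Sub-root f f0≡r)
      where
      vr : Adj (induced U (withV f)) zero (suc zero)
      vr e = sgn≢0 τ (trans (sym (linkEntry-vr v r τ)) (trans (cong (linkEntry v r τ v) (sym f0≡r)) (trans (sym (U-ct v (f zero))) e)))
    ... | no f0≢r = outcome-isolated f zero f0≢r (λ { zero → loopless (f zero) })
    outcome (suc (suc k)) f f-injective with tree-hasInducedLeaves m T SG TR f f-injective zero r
    ... | inj₂ all-r with () ← f-injective zero (suc zero) (trans (all-r zero) (sym (all-r (suc zero))))
    ... | inj₁ (a , fa≢r , leaf) with any? (λ b → ¬? (T (f a) (f b) ≟ℤ + 0))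
    ...   | yes (b , ab) = outcome-pendant f a b fa≢r ab (λ j adj → leaf j b adj ab)
                             (outcome k (f ∘ punchIn₂ a b) (λ x y e → punchIn₂-injective a b x y (f-injective _ _ e)))
    ...   | no none      = outcome-isolated f a fa≢r no-edge
      where
      no-edge : ∀ b → T (f a) (f b) ≡ + 0
      no-edge b with T (f a) (f b) ≟ℤ + 0
      ... | yes e  = e
      ... | no adj = ⊥-elim (none (b , adj))

module Parity where

  open import Data.Nat using (zero; suc; _+_; _*_; _%_; _/_; s≤s; z≤n)
  open import Data.Nat.Properties using (+-suc; *-comm; +-identityʳ)
  open import Data.Nat.DivMod using (m≡m%n+[m/n]*n; m/n≡1+[m∸n]/n)
  open import Relation.Binary.PropositionalEquality

  private
    [2+x]/2 : ∀ x → suc (suc x) / 2 ≡ suc (x / 2)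
    [2+x]/2 x = m/n≡1+[m∸n]/n {suc (suc x)} {2} (s≤s (s≤s z≤n))

    q*2≡q+q : ∀ q → q * 2 ≡ q + q
    q*2≡q+q q = trans (*-comm q 2) (cong (q +_) (+-identityʳ q))

  [q+q]/2≡q : ∀ q → (q + q) / 2 ≡ q
  [q+q]/2≡q zero    = refl
  [q+q]/2≡q (suc q) = trans (cong (λ t → suc t / 2) (+-suc q q)) (trans ([2+x]/2 (q + q)) (cong suc ([q+q]/2≡q q)))

  even⇒≡half+half : ∀ n → n % 2 ≡ 0 → n ≡ n / 2 + n / 2
  even⇒≡half+half n e = trans (m≡m%n+[m/n]*n n 2) (trans (cong (_+ (n / 2) * 2) e) (q*2≡q+q (n / 2)))

  odd⇒≡1+half+half : ∀ n → n % 2 ≡ 1 → n ≡ suc (n / 2 + n / 2)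
  odd⇒≡1+half+half n e = trans (m≡m%n+[m/n]*n n 2) (trans (cong (_+ (n / 2) * 2) e) (cong suc (q*2≡q+q (n / 2))))

module Cases where

  open Determinant using (sign; sign-+; det-cong)
  open SignedPath using (pathDet; pathDet-even; pathDet-odd)
  open Matchings using (perfectMatching-cong)
  open CycleDeterminant using (det-cycle-even; det-cycle-odd)
  open Unicyclic using (mapRight-id)
  open Parity
  open import Data.Nat as ℕ using (ℕ; zero; suc; _%_; _/_; s≤s; z≤n)
  import Data.Nat.Properties as ℕP
  open import Data.Nat.Tactic.RingSolver as ℕRing using ()
  open import Data.Integer using (+_; -_; _*_; _+_)
  open import Data.Integer.Properties using (*-zeroʳ; *-comm)
  open import Data.Fin using (Fin; zero; suc)
  open import Data.Product using (Σ; _,_; _×_)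
  open import Relation.Binary.PropositionalEquality
  open import Relation.Nullary using (¬_)
  open import Data.Empty using (⊥-elim)

  module Parts (k : ℕ) (σ : Fin (suc (suc (suc k))) → Sgn) (v : Fin (suc (suc (suc k))))
    (m : ℕ) (T : Matrix m) (SG : IsSignedGraph T) (TR : IsTree T) (r : Fin m) (τ : Sgn) where

    open Unicyclic.Reduction (suc (suc k)) (s≤s (s≤s z≤n)) σ v m T SG TR r τ

    private
      even-shape : N % 2 ≡ 0 → Σ ℕ λ q → N / 2 ≡ suc q × suc k ≡ q ℕ.+ q
      even-shape even with N / 2 | even⇒≡half+half N even
      ... | suc q | N≡ = q , refl , ℕP.suc-injective (ℕP.suc-injective (trans N≡ (cong suc (ℕP.+-suc q q))))

      odd-shape : N % 2 ≡ 1 → Σ ℕ λ q → N / 2 ≡ suc q × suc k ≡ suc (q ℕ.+ q)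
      odd-shape odd with N / 2 | odd⇒≡1+half+half N odd
      ... | suc q | N≡ = q , refl , trans (ℕP.suc-injective (ℕP.suc-injective N≡)) (ℕP.+-suc q q)

      reduction : Outcome (λ a → a)
      reduction = outcome m (λ a → a) (λ _ _ e → e)

      det-U : det U ≡ det (Sub (λ a → a))
      det-U = det-cong λ i j → sym (cong₂ U (mapRight-id N i) (mapRight-id N j))

      withV-id : ∀ i j → induced U (treePlusV N v m) i j ≡ induced U (withV (λ a → a)) i j
      withV-id zero    zero    = refl
      withV-id zero    (suc j) = refl
      withV-id (suc i) zero    = refl
      withV-id (suc i) (suc j) = refl

    det-U-even-unmatched : N % 2 ≡ 0 → ¬ PerfectMatching T → det U ≡ + 0
    det-U-even-unmatched even ¬pm with reduction | even-shape even
    ... | treeMatched pm _ _ _ _ | _ = ⊥-elim (¬pm pm)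
    ... | vMatched _ _ p _ d | q , _ , e =
      trans det-U (trans d (trans (cong (λ t → sign (suc p) * pathDet (suc t)) e) (trans (cong (sign (suc p) *_) (pathDet-odd q)) (*-zeroʳ (sign (suc p))))))
    ... | unmatched _ _ d | _ = trans det-U d

    det-U-even-matched : N % 2 ≡ 0 → PerfectMatching T →
      det U ≡ sign (m / 2) * (- (+ 2 * δ σ) + + 2 * sign (N / 2))
    det-U-even-matched even pm with reduction | even-shape even
    ... | vMatched ¬pm _ _ _ _ | _ = ⊥-elim (¬pm pm)
    ... | unmatched ¬pm _ _ | _ = ⊥-elim (¬pm pm)
    ... | treeMatched _ _ p m≡2p d | q , N/2≡ , e = trans det-U (trans d (cong₂ _*_
      (cong sign (sym (trans (cong (_/ 2) m≡2p) ([q+q]/2≡q p))))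
      (trans (det-cycle-even k σ q e) (cong (λ t → - (+ 2 * δ σ) + + 2 * sign t) (sym N/2≡)))))

    det-U-odd-vMatched : N % 2 ≡ 1 → PerfectMatching (induced U (treePlusV N v m)) → det U ≡ sign ((m ℕ.+ N) / 2)
    det-U-odd-vMatched odd pmV with reduction
    ... | treeMatched _ ¬pmV _ _ _ = ⊥-elim (¬pmV (perfectMatching-cong withV-id pmV))
    ... | unmatched _ ¬pmV _ = ⊥-elim (¬pmV (perfectMatching-cong withV-id pmV))
    ... | vMatched _ _ p m≡1+2p d = trans det-U (trans d (trans
        (cong (λ t → sign (suc p) * pathDet t) (ℕP.suc-injective N≡))
        (trans (cong (sign (suc p) *_) (pathDet-even h)) (trans (sym (sign-+ (suc p) h)) (cong sign (sym m+N/2))))))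
      where
      h = N / 2
      N≡ : N ≡ suc (h ℕ.+ h)
      N≡ = odd⇒≡1+half+half N odd
      regroup : ∀ p h → suc (p ℕ.+ p) ℕ.+ suc (h ℕ.+ h) ≡ suc (p ℕ.+ h) ℕ.+ suc (p ℕ.+ h)
      regroup = ℕRing.solve-∀
      m+N/2 : (m ℕ.+ N) / 2 ≡ suc p ℕ.+ h
      m+N/2 = trans (cong (_/ 2) (trans (cong₂ ℕ._+_ m≡1+2p N≡) (regroup p h))) ([q+q]/2≡q (suc (p ℕ.+ h)))

    det-U-odd-matched : N % 2 ≡ 1 → PerfectMatching T → det U ≡ + 2 * δ σ * sign (m / 2)
    det-U-odd-matched odd pm with reduction | odd-shape odd
    ... | vMatched ¬pm _ _ _ _ | _ = ⊥-elim (¬pm pm)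
    ... | unmatched ¬pm _ _ | _ = ⊥-elim (¬pm pm)
    ... | treeMatched _ _ p m≡2p d | q , _ , e = trans det-U (trans d (trans
      (cong₂ _*_ (cong sign (sym (trans (cong (_/ 2) m≡2p) ([q+q]/2≡q p)))) (det-cycle-odd k σ q e))
      (*-comm (sign (m / 2)) (+ 2 * δ σ))))

open import Data.Nat using (ℕ; zero; suc; s≤s; _≤_; _%_; _/_; _+_)
open import Data.Integer using (+_; -_; _*_; _^_)
open import Data.Fin using (Fin)
open import Data.Product using (_×_; _,_)
open import Relation.Nullary using (¬_)
open import Relation.Binary.PropositionalEquality using (_≡_)

theorem8 : (n : ℕ) → 3 ≤ n → (σ : Fin n → Sgn) → (v : Fin n)
    → (m : ℕ) → (T : Matrix m) → IsSignedGraph T → IsTree T → (r : Fin m) → (τ : Sgn)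
    → ((n % 2 ≡ 0) → ¬ HasPerfectMatching T
    → det (unicyclic n σ v m T r τ) ≡ + 0)
    × ((n % 2 ≡ 0) → HasPerfectMatching T
    → det (unicyclic n σ v m T r τ)
    ≡ ((- + 1) ^ (m / 2)) Data.Integer.* ((- (+ 2 * δ σ)) Data.Integer.+ (+ 2 * ((- + 1) ^ (n / 2)))))
    × ((n % 2 ≡ 1) → HasPerfectMatching (induced (unicyclic n σ v m T r τ) (treePlusV n v m))
    → det (unicyclic n σ v m T r τ) ≡ (- + 1) ^ ((m + n) / 2))
    × ((n % 2 ≡ 1) → HasPerfectMatching T
    → det (unicyclic n σ v m T r τ) ≡ + 2 * δ σ * ((- + 1) ^ (m / 2)))
theorem8 (suc zero)          (s≤s ())
theorem8 (suc (suc zero))    (s≤s (s≤s ()))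
theorem8 (suc (suc (suc k))) _ σ v m T SG TR r τ = det-U-even-unmatched , det-U-even-matched , det-U-odd-vMatched , det-U-odd-matched
  where open Cases.Parts k σ v m T SG TR r τ
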